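{- Let $k\ge1$, $p\in[0,1]$, and $n$ divisible by $k+1$. Let $\sigma$ be a set of $k+1$ vertices of $G_{n,k,p}$ containing exactly one vertex from each part. Conditional on $\sigma$ being a clique in $G_{n,k,p}$, the degree $\deg(\sigma)$ of $\sigma$ in the $k$-simplex graph of the clique complex of $G_{n,k,p}$ is distributed as $\mathrm{Binom}(n-k-1,p^k)$; that is, for every $i$, $\Pr[\deg(\sigma)=i\mid\sigma\text{ is a clique}]=\binom{n-k-1}{i}p^{ki}(1-p^k)^{n-k-1-i}$.
   Context: The $(k+1)$-partite Erdős–Rényi random graph $G_{n,k,p}$ is the random graph on vertex set $\{1,\dots,n\}$ partitioned into $k+1$ parts of equal size, in which each pair of vertices in different parts is joined independently with probability $p$, and pairs in the same part are never joined. The clique complex of a graph is the simplicial complex whose simplices are the vertex sets of complete subgraphs; its $k$-simplices are the $(k+1)$-cliques. The $k$-simplex graph has as vertices the $k$-simplices, with $\sigma\neq\tau$ adjacent iff $|\sigma\cap\tau|=k$ and $\sigma\cup\tau$ is not a simplex; $\deg(\sigma)$ is the degree in this graph.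
   Formalization: The edge probability p takes only rational values in [0,1]. -}

module Defs where

open import Data.Bool using (Bool; true; false; _∧_; _∨_; not; if_then_else_)
open import Data.Nat using (ℕ; zero; suc; _∸_; _≡ᵇ_; _<ᵇ_)
import Data.Nat as ℕ
open import Data.Nat.DivMod using (_%_)
open import Data.Nat.Combinatorics using (_C_)
open import Data.Fin using (Fin; toℕ)
open import Data.Fin.Subset using (Subset; _∩_; _∪_; ∣_∣)
open import Data.List using (List; []; _∷_; map; concatMap; filterᵇ; length; foldr; allFin; cartesianProduct)
open import Data.Vec using (Vec; []; _∷_; lookup)
open import Data.Bool.ListAction using (all)
open import Data.Product using (_×_; _,_; proj₁; proj₂)
open import Data.Rational using (ℚ; 0ℚ; 1ℚ; _+_; _*_; _-_)
import Data.Rational as ℚ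
open import Data.Integer using (+_)

_≟ᶠ_ : ∀ {n} → Fin n → Fin n → Bool
u ≟ᶠ v = toℕ u ≡ᵇ toℕ v

-- The (k+1) parts of {0,…,n-1}: vertex v lies in part (v mod (k+1)).
-- When (k+1) ∣ n all parts have size n/(k+1).
part : ℕ → ∀ {n} → Fin n → ℕ
part k v = toℕ v % suc k

potentialEdges : (n k : ℕ) → List (Fin n × Fin n)
potentialEdges n k =
  filterᵇ (λ e → (toℕ (proj₁ e) <ᵇ toℕ (proj₂ e)) ∧ not (part k (proj₁ e) ≡ᵇ part k (proj₂ e)))
          (cartesianProduct (allFin n) (allFin n))

-- All Boolean lists of a given length (outcomes of the edge coin flips).
allBools : ℕ → List (List Bool)
allBools zero = [] ∷ []
allBools (suc m) = concatMap (λ bs → (true ∷ bs) ∷ (false ∷ bs) ∷ []) (allBools m)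

allSubsets : (n : ℕ) → List (Subset n)
allSubsets zero = [] ∷ []
allSubsets (suc m) = concatMap (λ s → (true ∷ s) ∷ (false ∷ s) ∷ []) (allSubsets m)

-- An outcome (graph) is a list of Booleans aligned with potentialEdges n k.
Outcome : Set
Outcome = List Bool

adjAux : ∀ {n} → List (Fin n × Fin n) → List Bool → Fin n → Fin n → Bool
adjAux [] _ u v = false
adjAux (_ ∷ _) [] u v = false
adjAux ((a , b) ∷ es) (x ∷ xs) u v =
  if ((a ≟ᶠ u) ∧ (b ≟ᶠ v)) ∨ ((a ≟ᶠ v) ∧ (b ≟ᶠ u)) then x else adjAux es xs u v

adj : (n k : ℕ) → Outcome → Fin n → Fin n → Bool
adj n k G = adjAux (potentialEdges n k) G

-- S spans a complete subgraph (i.e. S is a simplex of the clique complex)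
isClique : (n k : ℕ) → Outcome → Subset n → Bool
isClique n k G S =
  all (λ e → let u = proj₁ e ; v = proj₂ e in
             not (lookup S u ∧ lookup S v ∧ not (u ≟ᶠ v)) ∨ adj n k G u v)
      (cartesianProduct (allFin n) (allFin n))

-- degree of the k-simplex σ in the k-simplex graph: number of k-simplices τ
-- ((k+1)-cliques) with |σ ∩ τ| = k and σ ∪ τ not a simplex.
deg : (n k : ℕ) → Outcome → Subset n → ℕ
deg n k G σ =
  length (filterᵇ (λ τ → (∣ τ ∣ ≡ᵇ suc k) ∧ isClique n k G τ
                         ∧ (∣ σ ∩ τ ∣ ≡ᵇ k) ∧ not (isClique n k G (σ ∪ τ)))
                  (allSubsets n))

_^ℚ_ : ℚ → ℕ → ℚ
x ^ℚ zero = 1ℚ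
x ^ℚ suc m = x * (x ^ℚ m)

fromℕℚ : ℕ → ℚ
fromℕℚ m = + m ℚ./ 1

weight : ℚ → Outcome → ℚ
weight p = foldr (λ b w → (if b then p else (1ℚ - p)) * w) 1ℚ

Pr : (n k : ℕ) → ℚ → (Outcome → Bool) → ℚ
Pr n k p E =
  foldr (λ G acc → (if E G then weight p G else 0ℚ) + acc) 0ℚ
        (allBools (length (potentialEdges n k)))

binomPMF : ℕ → ℚ → ℕ → ℚ
binomPMF N q i = fromℕℚ (N C i) * (q ^ℚ i) * ((1ℚ - q) ^ℚ (N ∸ i))

module Submission where

-- Given that σ is a clique, the k-simplices τ adjacent to σ are exactly the sets
-- τ = σ - u + w where w ∉ σ is joined to the k vertices of σ outside the part of w, and u is the
-- vertex of σ in that part: the k + 1 vertices of σ lie in distinct parts, so σ meets each of the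
-- k + 1 parts exactly once, and since u and w share a part, σ ∪ τ is never a clique.  So deg σ
-- counts the n - k - 1 vertices w ∉ σ joined to all of σ outside their part.  These events are
-- decided by pairwise disjoint sets of k potential edges, disjoint also from the edges inside σ;
-- hence, given that σ is a clique, they are independent events of probability p ^ k, and their
-- number is Binom(n - k - 1, p ^ k).

open import Defs

module Booleans where

  open import Data.Bool using (true; false; T; _∧_; _∨_; not)
  open import Data.Empty using (⊥-elim)
  open import Data.Unit using (tt)
  open import Relation.Binary.PropositionalEquality using (_≡_; refl; cong)
  open import Relation.Nullary using (¬_; Dec; yes; no; does)

  does⇒ : ∀ {A : Set} (a? : Dec A) → T (does a?) → A
  does⇒ (yes a) _ = a

  ⇒does : ∀ {A : Set} (a? : Dec A) → A → T (does a?)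
  ⇒does (yes _) _ = tt
  ⇒does (no ¬a) a = ¬a a

  ¬T⇒≡false : ∀ {b} → ¬ T b → b ≡ false
  ¬T⇒≡false {false} _  = refl
  ¬T⇒≡false {true}  ¬t = ⊥-elim (¬t tt)

  T-not⁺ : ∀ {b} → ¬ T b → T (not b)
  T-not⁺ {false} _  = tt
  T-not⁺ {true}  ¬t = ¬t tt

  T-not⁻ : ∀ {b} → T (not b) → ¬ T b
  T-not⁻ {false} _ ()

  implies⁺ : ∀ {c a} → (T c → T a) → T (not c ∨ a)
  implies⁺ {true}  c⇒a = c⇒a tt
  implies⁺ {false} _   = tt

  implies⁻ : ∀ {c a} → T (not c ∨ a) → T c → T a
  implies⁻ {true} t _ = t

  implies-cong : ∀ {c a a′} → (T c → a ≡ a′) → (not c ∨ a) ≡ (not c ∨ a′)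
  implies-cong {true}  c⇒a≡a′ = cong (false ∨_) (c⇒a≡a′ tt)
  implies-cong {false} _      = refl

  ∧-cong-T : ∀ {c a a′} → (T c → a ≡ a′) → (c ∧ a) ≡ (c ∧ a′)
  ∧-cong-T {true}  c⇒a≡a′ = c⇒a≡a′ tt
  ∧-cong-T {false} _      = refl

module Counting where

  open Booleans
  open import Data.Bool using (Bool; true; false; T; _∧_; _∨_; not)
  open import Data.Bool.Properties using (T-∧; ∨-zeroʳ; ∨-identityʳ; ∧-identityʳ; ∧-zeroʳ)
  open import Data.Empty using (⊥-elim)
  open import Data.Fin using (Fin; zero; suc; _≟_)
  import Data.Fin.Properties as Fin
  open import Data.Nat using (ℕ; zero; suc; _+_; _≤_; z≤n; s≤s)
  import Data.Nat.Properties as ℕ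
  open import Data.Product using (∃!; _×_; _,_; proj₁; proj₂)
  open import Data.Unit using (tt)
  open import Function using (_∘_; case_of_)
  open import Function.Bundles using (Equivalence)
  open import Relation.Binary.PropositionalEquality
  open import Relation.Nullary using (¬_; yes; no; does)
  open import Relation.Nullary.Decidable using (dec-true)
  open import Algebra.Properties.CommutativeMonoid.Sum ℕ.+-0-commutativeMonoid
    using (sum-syntax; ∑-comm; ∑-distrib-+; sum-cong-≗)

  𝟙ℕ : Bool → ℕ
  𝟙ℕ true  = 1
  𝟙ℕ false = 0

  count : ∀ {n} → (Fin n → Bool) → ℕ
  count {n} h = ∑[ x < n ] 𝟙ℕ (h x)

  count-cong : ∀ {n} {h g : Fin n → Bool} → (∀ x → h x ≡ g x) → count h ≡ count g
  count-cong h≗g = sum-cong-≗ (cong 𝟙ℕ ∘ h≗g)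

  count-split : ∀ {n} (h g : Fin n → Bool) →
                count h ≡ count (λ x → h x ∧ g x) + count (λ x → h x ∧ not (g x))
  count-split h g =
    trans (sum-cong-≗ (λ x → 𝟙ℕ-split (h x) (g x))) (∑-distrib-+ (𝟙ℕ ∘ (λ x → h x ∧ g x)) _)
    where
    𝟙ℕ-split : ∀ a b → 𝟙ℕ a ≡ 𝟙ℕ (a ∧ b) + 𝟙ℕ (a ∧ not b)
    𝟙ℕ-split true  true  = refl
    𝟙ℕ-split true  false = refl
    𝟙ℕ-split false _     = refl

  count≡0 : ∀ {n} {h : Fin n → Bool} → (∀ x → ¬ T (h x)) → count h ≡ 0
  count≡0 {zero}            none = refl
  count≡0 {suc n} {h} none with h zero | none zero
  ... | false | _  = count≡0 {h = h ∘ suc} (none ∘ suc)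
  ... | true  | ¬t = ⊥-elim (¬t _)

  count≡0⇒¬T : ∀ {n} {h : Fin n → Bool} → count h ≡ 0 → ∀ x → ¬ T (h x)
  count≡0⇒¬T {suc n} {h} c≡0 x with h zero in eq
  count≡0⇒¬T {suc n} {h} c≡0 zero    | false = subst T eq
  count≡0⇒¬T {suc n} {h} c≡0 (suc x) | false = count≡0⇒¬T {h = h ∘ suc} c≡0 x

  count≡1 : ∀ {n} {h : Fin n → Bool} → ∃! _≡_ (T ∘ h) → count h ≡ 1
  count≡1 {suc n} {h} (zero , t , unique) with h zero
  ... | true  = cong suc (count≡0 {h = h ∘ suc} λ y t′ → case unique {suc y} t′ of λ ())
  ... | false = ⊥-elim t
  count≡1 {suc n} {h} (suc x , t , unique) with h zero in eq
  ... | false = count≡1 {h = h ∘ suc} (x , t , λ {y} t′ → Fin.suc-injective (unique {suc y} t′))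
  ... | true  = case unique {zero} (subst T (sym eq) _) of λ ()

  count≡1⇒∃! : ∀ {n} {h : Fin n → Bool} → count h ≡ 1 → ∃! _≡_ (T ∘ h)
  count≡1⇒∃! {suc n} {h} c≡1 with h zero in eq
  ... | true  = zero , subst T (sym eq) _ , only-zero
    where
    only-zero : ∀ {y} → T (h y) → zero ≡ y
    only-zero {zero}  _ = refl
    only-zero {suc y} t = ⊥-elim (count≡0⇒¬T {h = h ∘ suc} (ℕ.suc-injective c≡1) y t)
  ... | false with count≡1⇒∃! {h = h ∘ suc} c≡1
  ...   | x , t , unique =
    suc x , t , λ { {zero} t′ → ⊥-elim (subst T eq t′) ; {suc y} t′ → cong suc (unique t′) }

  count≤1 : ∀ {n} {h : Fin n → Bool} → (∀ {x y} → T (h x) → T (h y) → x ≡ y) → count h ≤ 1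
  count≤1 {zero}      _      = z≤n
  count≤1 {suc n} {h} unique with h zero in eq
  ... | true  = ℕ.≤-reflexive (cong suc (count≡0 {h = h ∘ suc} λ y t →
                  case unique {zero} {suc y} (subst T (sym eq) _) t of λ ()))
  ... | false = count≤1 {h = h ∘ suc} (λ {x} {y} t t′ → Fin.suc-injective (unique {suc x} {suc y} t t′))

  count-remove : ∀ {n} (h : Fin n → Bool) {u} → T (h u) →
                 count h ≡ suc (count (λ x → h x ∧ not (does (x ≟ u))))
  count-remove h {u} hu =
    trans (count-split h (λ x → does (x ≟ u))) (cong (_+ count (λ x → h x ∧ not (does (x ≟ u)))) u-only)
    where
    u-only : count (λ x → h x ∧ does (x ≟ u)) ≡ 1
    u-only = count≡1 (u , Equivalence.from T-∧ (hu , ⇒does (u ≟ u) refl) ,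
                      λ {y} t → sym (does⇒ (y ≟ u) (proj₂ (Equivalence.to T-∧ t))))

  count-insert : ∀ {n} (h : Fin n → Bool) {w} → ¬ T (h w) →
                 count (λ x → h x ∨ does (x ≟ w)) ≡ suc (count h)
  count-insert h {w} ¬hw =
    trans (count-split _ (λ x → does (x ≟ w))) (cong₂ _+_ (count≡1 (w , w∈ , unique)) (count-cong outside-w))
    where
    w∈ : T ((h w ∨ does (w ≟ w)) ∧ does (w ≟ w))
    w∈ rewrite dec-true (w ≟ w) refl | ∨-zeroʳ (h w) = tt
    unique : ∀ {y} → T ((h y ∨ does (y ≟ w)) ∧ does (y ≟ w)) → w ≡ y
    unique {y} t = sym (does⇒ (y ≟ w) (proj₂ (Equivalence.to T-∧ t)))
    outside-w : ∀ x → (h x ∨ does (x ≟ w)) ∧ not (does (x ≟ w)) ≡ h x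
    outside-w x with x ≟ w
    ... | yes refl = trans (∧-zeroʳ _) (sym (¬T⇒≡false ¬hw))
    ... | no  _    = trans (∧-identityʳ _) (∨-identityʳ (h x))

  count-∧not≡1 : ∀ {n k} (h g : Fin n → Bool) → count h ≡ suc k → count (λ x → h x ∧ g x) ≡ k →
                 count (λ x → h x ∧ not (g x)) ≡ 1
  count-∧not≡1 {k = k} h g |h|≡1+k |h∧g|≡k = ℕ.+-cancelˡ-≡ k _ _ (begin
    k + count (λ x → h x ∧ not (g x))                        ≡⟨ cong (_+ _) |h∧g|≡k ⟨
    count (λ x → h x ∧ g x) + count (λ x → h x ∧ not (g x))  ≡⟨ count-split h g ⟨
    count h                                                  ≡⟨ |h|≡1+k ⟩
    suc k                                                    ≡⟨ ℕ.+-comm 1 k ⟩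
    k + 1                                                    ∎)
    where open ≡-Reasoning

  count-fibres : ∀ {n K} (h : Fin n → Bool) (f : Fin n → Fin K) →
                 count h ≡ ∑[ c < K ] count (λ x → h x ∧ does (f x ≟ c))
  count-fibres {n} {K} h f =
    trans (sum-cong-≗ 𝟙ℕ≡fibreCount) (∑-comm (λ x c → 𝟙ℕ (h x ∧ does (f x ≟ c))))
    where
    𝟙ℕ≡fibreCount : ∀ x → 𝟙ℕ (h x) ≡ count (λ c → h x ∧ does (f x ≟ c))
    𝟙ℕ≡fibreCount x with h x
    ... | true  = sym (count≡1 {h = λ c → does (f x ≟ c)} (f x , ⇒does (f x ≟ f x) refl , does⇒ (f x ≟ _)))
    ... | false = sym (count≡0 {K} {λ _ → false} λ _ ())

  ∑≤ : ∀ {K} (g : Fin K → ℕ) → (∀ c → g c ≤ 1) → ∑[ c < K ] g c ≤ K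
  ∑≤ {zero}  g _  = z≤n
  ∑≤ {suc K} g ≤1 = ℕ.+-mono-≤ (≤1 zero) (∑≤ (g ∘ suc) (≤1 ∘ suc))

  ∑≡⇒head≡1 : ∀ {K} (g : Fin (suc K) → ℕ) → (∀ c → g c ≤ 1) → ∑[ c < suc K ] g c ≡ suc K →
              g zero ≡ 1 × ∑[ c < K ] g (suc c) ≡ K
  ∑≡⇒head≡1 g ≤1 ∑≡K with g zero | ≤1 zero
  ... | 0 | z≤n     = ⊥-elim (ℕ.<-irrefl ∑≡K (s≤s (∑≤ (g ∘ suc) (≤1 ∘ suc))))
  ... | 1 | s≤s z≤n = refl , ℕ.suc-injective ∑≡K

  ∑≡⇒all≡1 : ∀ {K} (g : Fin K → ℕ) → (∀ c → g c ≤ 1) → ∑[ c < K ] g c ≡ K → ∀ c → g c ≡ 1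
  ∑≡⇒all≡1 g ≤1 ∑≡K zero    = proj₁ (∑≡⇒head≡1 g ≤1 ∑≡K)
  ∑≡⇒all≡1 g ≤1 ∑≡K (suc c) =
    ∑≡⇒all≡1 (g ∘ suc) (≤1 ∘ suc) (proj₂ (∑≡⇒head≡1 g ≤1 ∑≡K)) c

  fibres-of-transversal : ∀ {n K} (h : Fin n → Bool) (f : Fin n → Fin K) → count h ≡ K →
                          (∀ {x y} → T (h x) → T (h y) → f x ≡ f y → x ≡ y) →
                          ∀ c → count (λ x → h x ∧ does (f x ≟ c)) ≡ 1
  fibres-of-transversal h f |h|≡K injective =
    ∑≡⇒all≡1 _ fibre≤1 (trans (sym (count-fibres h f)) |h|≡K)
    where
    fibre≤1 : ∀ c → count (λ x → h x ∧ does (f x ≟ c)) ≤ 1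
    fibre≤1 c = count≤1 λ tx ty →
      let (hx , fx≡c) = Equivalence.to T-∧ tx ; (hy , fy≡c) = Equivalence.to T-∧ ty
      in injective hx hy (trans (does⇒ (f _ ≟ c) fx≡c) (sym (does⇒ (f _ ≟ c) fy≡c)))

  allᶠ : ∀ {n} → (Fin n → Bool) → Bool
  allᶠ {zero}  _ = true
  allᶠ {suc n} h = h zero ∧ allᶠ (h ∘ suc)

  allᶠ-cong : ∀ {n} {h g : Fin n → Bool} → (∀ x → h x ≡ g x) → allᶠ h ≡ allᶠ g
  allᶠ-cong {zero}  _   = refl
  allᶠ-cong {suc n} h≗g = cong₂ _∧_ (h≗g zero) (allᶠ-cong (h≗g ∘ suc))

  allᶠ⁺ : ∀ {n} {h : Fin n → Bool} → (∀ x → T (h x)) → T (allᶠ h)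
  allᶠ⁺ {zero}  _   = tt
  allᶠ⁺ {suc n} all = Equivalence.from T-∧ (all zero , allᶠ⁺ (all ∘ suc))

  allᶠ⁻ : ∀ {n} {h : Fin n → Bool} → T (allᶠ h) → ∀ x → T (h x)
  allᶠ⁻ {suc n} t zero    = proj₁ (Equivalence.to T-∧ t)
  allᶠ⁻ {suc n} t (suc x) = allᶠ⁻ (proj₂ (Equivalence.to T-∧ t)) x

module SubsetEnumeration where

  open Booleans
  open Counting
  open import Data.Bool using (Bool; true; false; T; _∧_)
  import Data.Bool.Properties as Bool
  open import Data.Bool.Properties using (T-∧)
  open import Data.Fin using (Fin)
  open import Data.Fin.Subset using (Subset; ∣_∣)
  open import Data.List using ([]; _∷_; map; concatMap; length; filterᵇ)
  open import Data.List.Properties using (map-cong)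
  open import Data.Nat using (ℕ; zero; suc; _+_)
  open import Data.Nat.ListAction using (sum)
  import Data.Nat.Properties as ℕ
  open import Data.Product using (∃; _×_; _,_)
  open import Data.Unit using (tt)
  open import Data.Vec using ([]; _∷_; lookup)
  import Data.Vec.Properties as Vec
  open import Function using (_∘_)
  open import Function.Bundles using (Equivalence)
  open import Relation.Binary.Definitions using (DecidableEquality)
  open import Relation.Binary.PropositionalEquality
  open import Relation.Nullary using (does)
  open import Algebra.Properties.CommutativeMonoid.Sum ℕ.+-0-commutativeMonoid
    using (sum-syntax; ∑-distrib-+; sum-cong-≗; sum-replicate-zero)

  ∣p∣≡count : ∀ {n} (p : Subset n) → ∣ p ∣ ≡ count (lookup p)
  ∣p∣≡count []          = refl
  ∣p∣≡count (true  ∷ p) = cong suc (∣p∣≡count p)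
  ∣p∣≡count (false ∷ p) = ∣p∣≡count p

  infix 4 _≟ˢ_
  _≟ˢ_ : ∀ {n} → DecidableEquality (Subset n)
  _≟ˢ_ = Vec.≡-dec Bool._≟_

  length-filterᵇ : ∀ {A : Set} (P : A → Bool) xs → length (filterᵇ P xs) ≡ sum (map (𝟙ℕ ∘ P) xs)
  length-filterᵇ P []       = refl
  length-filterᵇ P (x ∷ xs) with P x
  ... | true  = cong suc (length-filterᵇ P xs)
  ... | false = length-filterᵇ P xs

  sum-map-∑ : ∀ {A : Set} {n} (F : Fin n → A → ℕ) xs →
              sum (map (λ a → ∑[ x < n ] F x a) xs) ≡ ∑[ x < n ] sum (map (F x) xs)
  sum-map-∑ {n = n} F []       = sym (sum-replicate-zero n)
  sum-map-∑         F (a ∷ as) = trans (cong (_ +_) (sum-map-∑ F as)) (sym (∑-distrib-+ (λ x → F x a) _))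

  sum-allSubsets-δ : ∀ {n} b (t : Subset n) →
                     sum (map (λ τ → 𝟙ℕ (b ∧ does (τ ≟ˢ t))) (allSubsets n)) ≡ 𝟙ℕ b
  sum-allSubsets-δ {zero}  b [] = trans (ℕ.+-identityʳ _) (cong 𝟙ℕ (Bool.∧-identityʳ b))
  sum-allSubsets-δ {suc n} b (x ∷ t) = begin
    sum (map F (concatMap (λ s → (true ∷ s) ∷ (false ∷ s) ∷ []) (allSubsets n)))
      ≡⟨ sum-pairs (allSubsets n) ⟩
    sum (map (λ s → F (true ∷ s) + F (false ∷ s)) (allSubsets n))
      ≡⟨ cong sum (map-cong (pair-δ b x) (allSubsets n)) ⟩
    sum (map (λ s → 𝟙ℕ (b ∧ does (s ≟ˢ t))) (allSubsets n))
      ≡⟨ sum-allSubsets-δ b t ⟩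
    𝟙ℕ b ∎
    where
    open ≡-Reasoning
    F : Subset (suc n) → ℕ
    F τ = 𝟙ℕ (b ∧ does (τ ≟ˢ x ∷ t))
    sum-pairs : ∀ ss → sum (map F (concatMap (λ s → (true ∷ s) ∷ (false ∷ s) ∷ []) ss))
                     ≡ sum (map (λ s → F (true ∷ s) + F (false ∷ s)) ss)
    sum-pairs []       = refl
    sum-pairs (s ∷ ss) = trans (sym (ℕ.+-assoc (F (true ∷ s)) _ _)) (cong (_ +_) (sum-pairs ss))
    pair-δ : ∀ c y (s : Subset n) →
             𝟙ℕ (c ∧ does (true ∷ s ≟ˢ y ∷ t)) + 𝟙ℕ (c ∧ does (false ∷ s ≟ˢ y ∷ t)) ≡ 𝟙ℕ (c ∧ does (s ≟ˢ t))
    pair-δ true  true  s = ℕ.+-identityʳ (𝟙ℕ (does (s ≟ˢ t)))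
    pair-δ true  false s = refl
    pair-δ false _     s = refl

  length-filter≡count-preimage : ∀ {m n} (P : Subset m → Bool) (g : Fin n → Bool) (f : Fin n → Subset m) →
    (∀ {x y} → T (g x) → T (g y) → f x ≡ f y → x ≡ y) →
    (∀ {x} → T (g x) → T (P (f x))) →
    (∀ {τ} → T (P τ) → ∃ λ x → T (g x) × τ ≡ f x) →
    length (filterᵇ P (allSubsets m)) ≡ count g
  length-filter≡count-preimage {m} {n} P g f injective into onto = begin
    length (filterᵇ P (allSubsets m))
      ≡⟨ length-filterᵇ P (allSubsets m) ⟩
    sum (map (𝟙ℕ ∘ P) (allSubsets m))
      ≡⟨ cong sum (map-cong 𝟙ℕ∘P≡preimageCount (allSubsets m)) ⟩
    sum (map (λ τ → count (λ x → g x ∧ does (τ ≟ˢ f x))) (allSubsets m))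
      ≡⟨ sum-map-∑ (λ x τ → 𝟙ℕ (g x ∧ does (τ ≟ˢ f x))) (allSubsets m) ⟩
    ∑[ x < n ] sum (map (λ τ → 𝟙ℕ (g x ∧ does (τ ≟ˢ f x))) (allSubsets m))
      ≡⟨ sum-cong-≗ (λ x → sum-allSubsets-δ (g x) (f x)) ⟩
    count g ∎
    where
    open ≡-Reasoning
    preimage-unique : ∀ {τ x} → T (g x) → τ ≡ f x → ∀ {y} → T (g y ∧ does (τ ≟ˢ f y)) → x ≡ y
    preimage-unique {τ} gx τ≡fx {y} t =
      let (gy , τ≟fy) = Equivalence.to T-∧ t in injective gx gy (trans (sym τ≡fx) (does⇒ (τ ≟ˢ f y) τ≟fy))
    𝟙ℕ∘P≡preimageCount : ∀ τ → 𝟙ℕ (P τ) ≡ count (λ x → g x ∧ does (τ ≟ˢ f x))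
    𝟙ℕ∘P≡preimageCount τ with P τ in eq
    ... | true  = let (x , gx , τ≡fx) = onto (subst T (sym eq) tt) in
      sym (count≡1 (x , Equivalence.from T-∧ (gx , ⇒does (τ ≟ˢ f x) τ≡fx) , preimage-unique gx τ≡fx))
    ... | false = sym (count≡0 λ x t →
      let (gx , τ≟fx) = Equivalence.to T-∧ t
      in subst T eq (subst (T ∘ P) (sym (does⇒ (τ ≟ˢ f x) τ≟fx)) (into gx)))

module CoinFlips where

  open import Data.Bool using (Bool; true; false; if_then_else_)
  open import Data.Empty using (⊥-elim)
  open import Data.List using (List; []; _∷_; length; foldr; concatMap)
  open import Data.Nat using (ℕ; zero; suc; _<_; s≤s)
  open import Data.Rational using (ℚ; 0ℚ; 1ℚ; _+_; _*_; _-_)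
  import Data.Rational.Properties as ℚ
  open import Data.Rational.Solver using (module +-*-Solver)
  open import Data.Sum using (_⊎_; inj₁; inj₂)
  open import Function using (_∘_; flip)
  open import Level using (0ℓ)
  open import Relation.Binary.PropositionalEquality
  open import Relation.Nullary using (¬_; Dec; yes; no)
  open import Relation.Unary using (Pred; Decidable; ∁; _⊆_)
  open +-*-Solver

  𝟙 : Bool → ℚ
  𝟙 true  = 1ℚ
  𝟙 false = 0ℚ

  -- Coordinate j of an outcome records the j-th potential edge; past the end it reads as absent.
  coin : Outcome → ℕ → Bool
  coin []      _       = false
  coin (b ∷ _) zero    = b
  coin (_ ∷ G) (suc j) = coin G j

  _≈[_]_ : Outcome → Pred ℕ 0ℓ → Outcome → Set
  G ≈[ A ] G′ = ∀ {j} → A j → coin G j ≡ coin G′ j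

  record DependsOn {B : Set} (A : Pred ℕ 0ℓ) (f : Outcome → B) : Set where
    constructor dependsOn
    field respects : ∀ {G G′} → G ≈[ A ] G′ → f G ≡ f G′

  open DependsOn public

  module _ {B : Set} {A : Pred ℕ 0ℓ} {f : Outcome → B} (f-dep : DependsOn A f) where

    dependsOn-⊆ : ∀ {A′} → A ⊆ A′ → DependsOn A′ f
    dependsOn-⊆ A⊆A′ = dependsOn λ G≈G′ → f-dep .respects (G≈G′ ∘ A⊆A′)

    dependsOn-∘ : {C : Set} (g : B → C) → DependsOn A (g ∘ f)
    dependsOn-∘ g = dependsOn (cong g ∘ f-dep .respects)

    dependsOn-∷ : ∀ b → DependsOn (A ∘ suc) (f ∘ (b ∷_))
    dependsOn-∷ b = dependsOn λ G≈G′ → f-dep .respects λ { {zero} _ → refl ; {suc j} a → G≈G′ a }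

    dependsOn-head : ¬ A 0 → ∀ G → f (true ∷ G) ≡ f (false ∷ G)
    dependsOn-head ¬A0 G = f-dep .respects λ { {zero} a → ⊥-elim (¬A0 a) ; {suc j} _ → refl }

  module Bernoulli (p : ℚ) where

    𝔼 : ℕ → (Outcome → ℚ) → ℚ
    𝔼 zero    f = f []
    𝔼 (suc m) f = p * 𝔼 m (f ∘ (true ∷_)) + (1ℚ - p) * 𝔼 m (f ∘ (false ∷_))

    𝔼-cong : ∀ m {f g} → (∀ G → f G ≡ g G) → 𝔼 m f ≡ 𝔼 m g
    𝔼-cong zero    f≗g = f≗g []
    𝔼-cong (suc m) f≗g =
      cong₂ (λ a b → p * a + (1ℚ - p) * b) (𝔼-cong m (f≗g ∘ (true ∷_))) (𝔼-cong m (f≗g ∘ (false ∷_)))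

    𝔼-const : ∀ m c → 𝔼 m (λ _ → c) ≡ c
    𝔼-const zero    c = refl
    𝔼-const (suc m) c rewrite 𝔼-const m c = solve 2 (λ p c → p :* c :+ (con 1ℚ :- p) :* c := c) refl p c

    𝔼-+ : ∀ m f g → 𝔼 m (λ G → f G + g G) ≡ 𝔼 m f + 𝔼 m g
    𝔼-+ zero    f g = refl
    𝔼-+ (suc m) f g
      rewrite 𝔼-+ m (f ∘ (true ∷_)) (g ∘ (true ∷_)) | 𝔼-+ m (f ∘ (false ∷_)) (g ∘ (false ∷_)) =
      solve 5 (λ p a b c d → p :* (a :+ b) :+ (con 1ℚ :- p) :* (c :+ d)
                          := (p :* a :+ (con 1ℚ :- p) :* c) :+ (p :* b :+ (con 1ℚ :- p) :* d)) refl p _ _ _ _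

    𝔼-scale : ∀ m c f → 𝔼 m (λ G → c * f G) ≡ c * 𝔼 m f
    𝔼-scale zero    c f = refl
    𝔼-scale (suc m) c f rewrite 𝔼-scale m c (f ∘ (true ∷_)) | 𝔼-scale m c (f ∘ (false ∷_)) =
      solve 4 (λ p c a b → p :* (c :* a) :+ (con 1ℚ :- p) :* (c :* b) := c :* (p :* a :+ (con 1ℚ :- p) :* b))
            refl p c _ _

    𝔼-complement : ∀ m f → 𝔼 m (λ G → 1ℚ - f G) ≡ 1ℚ - 𝔼 m f
    𝔼-complement zero    f = refl
    𝔼-complement (suc m) f rewrite 𝔼-complement m (f ∘ (true ∷_)) | 𝔼-complement m (f ∘ (false ∷_)) =
      solve 3 (λ p a b → p :* (con 1ℚ :- a) :+ (con 1ℚ :- p) :* (con 1ℚ :- b)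
                      := con 1ℚ :- (p :* a :+ (con 1ℚ :- p) :* b)) refl p _ _

    𝔼-coin : ∀ {m j} → j < m → 𝔼 m (𝟙 ∘ flip coin j) ≡ p
    𝔼-coin {suc m} {zero}  _         rewrite 𝔼-const m 1ℚ | 𝔼-const m 0ℚ =
      solve 1 (λ p → p :* con 1ℚ :+ (con 1ℚ :- p) :* con 0ℚ := p) refl p
    𝔼-coin {suc m} {suc j} (s≤s j<m) rewrite 𝔼-coin j<m =
      solve 1 (λ p → p :* p :+ (con 1ℚ :- p) :* p := p) refl p

    𝔼-*-step : ∀ m (f g : Outcome → ℚ) →
      (∀ b → 𝔼 m (λ G → f (b ∷ G) * g (b ∷ G)) ≡ 𝔼 m (f ∘ (b ∷_)) * 𝔼 m (g ∘ (b ∷_))) →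
      (∀ G → g (true ∷ G) ≡ g (false ∷ G)) ⊎ (∀ G → f (true ∷ G) ≡ f (false ∷ G)) →
      𝔼 (suc m) (λ G → f G * g G) ≡ 𝔼 (suc m) f * 𝔼 (suc m) g
    𝔼-*-step m f g IH (inj₁ g-head) rewrite IH true | IH false | 𝔼-cong m (sym ∘ g-head) =
      solve 4 (λ p a b y → p :* (a :* y) :+ (con 1ℚ :- p) :* (b :* y)
                        := (p :* a :+ (con 1ℚ :- p) :* b) :* (p :* y :+ (con 1ℚ :- p) :* y)) refl p _ _ _
    𝔼-*-step m f g IH (inj₂ f-head) rewrite IH true | IH false | 𝔼-cong m (sym ∘ f-head) =
      solve 4 (λ p x a b → p :* (x :* a) :+ (con 1ℚ :- p) :* (x :* b)
                        := (p :* x :+ (con 1ℚ :- p) :* x) :* (p :* a :+ (con 1ℚ :- p) :* b)) refl p _ _ _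

    𝔼-* : ∀ m {A f g} → Decidable A → DependsOn A f → DependsOn (∁ A) g →
          𝔼 m (λ G → f G * g G) ≡ 𝔼 m f * 𝔼 m g
    𝔼-* zero    A? f-dep g-dep = refl
    𝔼-* (suc m) {A} {f} {g} A? f-dep g-dep = 𝔼-*-step m f g IH (head-irrelevant (A? 0))
      where
      IH : ∀ b → 𝔼 m (λ G → f (b ∷ G) * g (b ∷ G)) ≡ 𝔼 m (f ∘ (b ∷_)) * 𝔼 m (g ∘ (b ∷_))
      IH b = 𝔼-* m (A? ∘ suc) (dependsOn-∷ f-dep b) (dependsOn-∷ g-dep b)
      head-irrelevant : Dec (A 0) →
                        (∀ G → g (true ∷ G) ≡ g (false ∷ G)) ⊎ (∀ G → f (true ∷ G) ≡ f (false ∷ G))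
      head-irrelevant (yes A0)  = inj₁ (dependsOn-head g-dep (λ ¬A0 → ¬A0 A0))
      head-irrelevant (no ¬A0) = inj₂ (dependsOn-head f-dep ¬A0)

    private
      sumOver : List Outcome → (Outcome → ℚ) → ℚ
      sumOver Gs h = foldr (λ G acc → h G + acc) 0ℚ Gs

      sumOver-cong : ∀ Gs {h h′} → (∀ G → h G ≡ h′ G) → sumOver Gs h ≡ sumOver Gs h′
      sumOver-cong []       h≗h′ = refl
      sumOver-cong (G ∷ Gs) h≗h′ = cong₂ _+_ (h≗h′ G) (sumOver-cong Gs h≗h′)

      sumOver-pairs : ∀ Gs h → sumOver (concatMap (λ G → (true ∷ G) ∷ (false ∷ G) ∷ []) Gs) h
                             ≡ sumOver Gs (λ G → h (true ∷ G) + h (false ∷ G))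
      sumOver-pairs []       h = refl
      sumOver-pairs (G ∷ Gs) h rewrite sumOver-pairs Gs h = sym (ℚ.+-assoc (h (true ∷ G)) (h (false ∷ G)) _)

      weighted-sum≡𝔼 : ∀ m φ → sumOver (allBools m) (λ G → weight p G * φ G) ≡ 𝔼 m φ
      weighted-sum≡𝔼 zero    φ = solve 1 (λ y → con 1ℚ :* y :+ con 0ℚ := y) refl (φ [])
      weighted-sum≡𝔼 (suc m) φ = begin
        sumOver (allBools (suc m)) (λ G → weight p G * φ G)
          ≡⟨ sumOver-pairs (allBools m) (λ G → weight p G * φ G) ⟩
        sumOver (allBools m) (λ G → p * weight p G * φ (true ∷ G) + (1ℚ - p) * weight p G * φ (false ∷ G))
          ≡⟨ sumOver-cong (allBools m) (λ G → solve 4 (λ p w a b → p :* w :* a :+ (con 1ℚ :- p) :* w :* b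
                                                               := w :* (p :* a :+ (con 1ℚ :- p) :* b))
                                                       refl p (weight p G) _ _) ⟩
        sumOver (allBools m) (λ G → weight p G * φ′ G)
          ≡⟨ weighted-sum≡𝔼 m φ′ ⟩
        𝔼 m φ′
          ≡⟨ trans (𝔼-+ m _ _) (cong₂ _+_ (𝔼-scale m p _) (𝔼-scale m (1ℚ - p) _)) ⟩
        𝔼 (suc m) φ ∎
        where
        open ≡-Reasoning
        φ′ : Outcome → ℚ
        φ′ G = p * φ (true ∷ G) + (1ℚ - p) * φ (false ∷ G)

    Pr≡𝔼 : ∀ n k E → Pr n k p E ≡ 𝔼 (length (potentialEdges n k)) (𝟙 ∘ E)
    Pr≡𝔼 n k E = trans (sumOver-cong (allBools m) weight-if) (weighted-sum≡𝔼 m (𝟙 ∘ E))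
      where
      m = length (potentialEdges n k)
      weight-if : ∀ G → (if E G then weight p G else 0ℚ) ≡ weight p G * 𝟙 (E G)
      weight-if G with E G
      ... | true  = sym (ℚ.*-identityʳ (weight p G))
      ... | false = sym (ℚ.*-zeroʳ (weight p G))

module Binomial where

  open Booleans using (¬T⇒≡false)
  open Counting using (count; 𝟙ℕ; count-cong; allᶠ; allᶠ-cong)
  open CoinFlips
  open import Data.Bool using (Bool; true; false; T; _∧_; not)
  open import Data.Bool.Properties using (T-≡)
  open import Data.Fin using (Fin; zero; suc)
  import Data.Fin.Properties as Fin
  open import Data.Integer using (+_)
  import Data.Integer as ℤ
  import Data.Integer.Properties as ℤ
  open import Data.Nat using (ℕ; zero; suc; _∸_; _≡ᵇ_; _<?_; s≤s) renaming (_+_ to _+ℕ_)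
  open import Data.Nat.Combinatorics using (_C_; nCk+nC[k+1]≡[n+1]C[k+1]; k>n⇒nCk≡0)
  open import Data.Nat.Coprimality using (1-coprimeTo) renaming (sym to coprime-sym)
  import Data.Nat.Properties as ℕ
  open import Data.Rational using (ℚ; 0ℚ; 1ℚ; _+_; _*_; _-_; mkℚ; _/_)
  import Data.Rational.Properties as ℚ
  open import Data.Rational.Solver using (module +-*-Solver)
  open import Data.Unit using (tt)
  open import Function using (_∘_; case_of_)
  open import Function.Bundles using (Equivalence)
  open import Level using (0ℓ)
  open import Relation.Binary.PropositionalEquality
  open import Relation.Nullary using (¬_; yes; no)
  open import Relation.Unary using (Pred; Decidable; ∁; _⊆_)
  open +-*-Solver

  fromℕℚ≡mkℚ : ∀ a → fromℕℚ a ≡ mkℚ (+ a) 0 (coprime-sym (1-coprimeTo a))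
  fromℕℚ≡mkℚ a = ℚ.normalize-coprime (coprime-sym (1-coprimeTo a))

  -- Once both summands are in the normal form a / 1, ℚ-addition unfolds to (a * 1 + b * 1) / 1.
  fromℕℚ-+ : ∀ a b → fromℕℚ (a +ℕ b) ≡ fromℕℚ a + fromℕℚ b
  fromℕℚ-+ a b rewrite fromℕℚ≡mkℚ a | fromℕℚ≡mkℚ b =
    cong (_/ 1) (trans (ℤ.pos-+ a b) (sym (cong₂ ℤ._+_ (ℤ.*-identityʳ (+ a)) (ℤ.*-identityʳ (+ b)))))

  binomPMF-suc-zero : ∀ r q → binomPMF (suc r) q 0 ≡ (1ℚ - q) * binomPMF r q 0
  binomPMF-suc-zero r q =
    solve 2 (λ q e → con 1ℚ :* con 1ℚ :* ((con 1ℚ :- q) :* e) := (con 1ℚ :- q) :* (con 1ℚ :* con 1ℚ :* e))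
          refl q ((1ℚ - q) ^ℚ r)

  -- For i ≥ r the truncated subtractions r ∸ i and 1 + (r ∸ (1 + i)) differ, but then r C (1 + i) = 0.
  choose-pow-shift : ∀ r i q →
                     fromℕℚ (r C suc i) * q ^ℚ (r ∸ i) ≡ fromℕℚ (r C suc i) * (q * q ^ℚ (r ∸ suc i))
  choose-pow-shift r i q with i <? r
  ... | yes i<r = cong (λ e → fromℕℚ (r C suc i) * q ^ℚ e) (ℕ.+-∸-assoc 1 i<r)
  ... | no  i≮r rewrite k>n⇒nCk≡0 (s≤s (ℕ.≮⇒≥ i≮r)) =
    trans (ℚ.*-zeroˡ (q ^ℚ (r ∸ i))) (sym (ℚ.*-zeroˡ (q * q ^ℚ (r ∸ suc i))))

  binomPMF-suc-suc : ∀ r q i → binomPMF (suc r) q (suc i) ≡ q * binomPMF r q i + (1ℚ - q) * binomPMF r q (suc i)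
  binomPMF-suc-suc r q i = begin
    fromℕℚ (suc r C suc i) * (q * Q) * e
      ≡⟨ cong (λ c → c * (q * Q) * e) (trans (cong fromℕℚ (sym (nCk+nC[k+1]≡[n+1]C[k+1] r i)))
                                             (fromℕℚ-+ (r C i) (r C suc i))) ⟩
    (c₀ + c₁) * (q * Q) * e
      ≡⟨ solve 5 (λ q Q e c₀ c₁ → (c₀ :+ c₁) :* (q :* Q) :* e := q :* (c₀ :* Q :* e) :+ (q :* Q) :* (c₁ :* e))
               refl q Q e c₀ c₁ ⟩
    q * (c₀ * Q * e) + (q * Q) * (c₁ * e)
      ≡⟨ cong (λ x → q * (c₀ * Q * e) + (q * Q) * x) (choose-pow-shift r i (1ℚ - q)) ⟩
    q * (c₀ * Q * e) + (q * Q) * (c₁ * ((1ℚ - q) * e′))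
      ≡⟨ solve 5 (λ q Q e′ c₀e c₁ → q :* c₀e :+ (q :* Q) :* (c₁ :* ((con 1ℚ :- q) :* e′))
                                 := q :* c₀e :+ (con 1ℚ :- q) :* (c₁ :* (q :* Q) :* e′))
               refl q Q e′ (c₀ * Q * e) c₁ ⟩
    q * binomPMF r q i + (1ℚ - q) * binomPMF r q (suc i) ∎
    where
    open ≡-Reasoning
    Q  = q ^ℚ i
    e  = (1ℚ - q) ^ℚ (r ∸ i)
    e′ = (1ℚ - q) ^ℚ (r ∸ suc i)
    c₀ = fromℕℚ (r C i)
    c₁ = fromℕℚ (r C suc i)

  record Independent {n} (X : Fin n → Outcome → Bool) : Set₁ where
    field
      support   : Fin n → Pred ℕ 0ℓ
      support?  : ∀ x → Decidable (support x)
      disjoint  : ∀ {x y j} → support x j → support y j → x ≡ y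
      depends   : ∀ x → DependsOn (support x) (X x)

  module _ {n} {X : Fin n → Outcome → Bool} (X-ind : Independent X) where
    open Independent X-ind

    family-dependsOn : ∀ {A} → (∀ x → support x ⊆ A) →
                       {B : Set} (F : (Fin n → Bool) → B) → (∀ {h g} → (∀ x → h x ≡ g x) → F h ≡ F g) →
                       DependsOn A (λ G → F (λ x → X x G))
    family-dependsOn support⊆A F F-cong =
      dependsOn λ G≈G′ → F-cong λ x → dependsOn-⊆ (depends x) (support⊆A x) .respects G≈G′

  module _ {n} {X : Fin (suc n) → Outcome → Bool} (X-ind : Independent X) where
    open Independent X-ind

    independent-tail : Independent (X ∘ suc)
    independent-tail = record
      { support  = support ∘ suc
      ; support? = support? ∘ suc
      ; disjoint = λ s s′ → Fin.suc-injective (disjoint s s′)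
      ; depends  = depends ∘ suc
      }

    tail-dependsOn : {B : Set} (F : (Fin n → Bool) → B) → (∀ {h g} → (∀ x → h x ≡ g x) → F h ≡ F g) →
                     DependsOn (∁ (support zero)) (λ G → F (λ x → X (suc x) G))
    tail-dependsOn = family-dependsOn independent-tail (λ x s s₀ → case disjoint s s₀ of λ ())

  𝟙-∧ : ∀ a b → 𝟙 (a ∧ b) ≡ 𝟙 a * 𝟙 b
  𝟙-∧ true  b = sym (ℚ.*-identityˡ (𝟙 b))
  𝟙-∧ false b = sym (ℚ.*-zeroˡ (𝟙 b))

  𝟙-not : ∀ a → 𝟙 (not a) ≡ 1ℚ - 𝟙 a
  𝟙-not true  = refl
  𝟙-not false = refl

  𝟙-+≡ᵇ0 : ∀ b c → 𝟙 (𝟙ℕ b +ℕ c ≡ᵇ 0) ≡ 𝟙 (not b) * 𝟙 (c ≡ᵇ 0)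
  𝟙-+≡ᵇ0 true  c = sym (ℚ.*-zeroˡ (𝟙 (c ≡ᵇ 0)))
  𝟙-+≡ᵇ0 false c = sym (ℚ.*-identityˡ (𝟙 (c ≡ᵇ 0)))

  𝟙-+≡ᵇsuc : ∀ b c i → 𝟙 (𝟙ℕ b +ℕ c ≡ᵇ suc i) ≡ 𝟙 b * 𝟙 (c ≡ᵇ i) + 𝟙 (not b) * 𝟙 (c ≡ᵇ suc i)
  𝟙-+≡ᵇsuc true  c i =
    solve 2 (λ x y → x := con 1ℚ :* x :+ con 0ℚ :* y) refl (𝟙 (c ≡ᵇ i)) (𝟙 (c ≡ᵇ suc i))
  𝟙-+≡ᵇsuc false c i =
    solve 2 (λ x y → y := con 0ℚ :* x :+ con 1ℚ :* y) refl (𝟙 (c ≡ᵇ i)) (𝟙 (c ≡ᵇ suc i))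

  module _ (p : ℚ) where
    open Bernoulli p

    𝔼-allᶠ : ∀ m {n} {X : Fin n → Outcome → Bool} → Independent X → (M : Fin n → Bool) → ∀ {q} →
             (∀ x → T (M x) → 𝔼 m (𝟙 ∘ X x) ≡ q) → (∀ x → ¬ T (M x) → ∀ G → T (X x G)) →
             𝔼 m (λ G → 𝟙 (allᶠ (λ x → X x G))) ≡ q ^ℚ count M
    𝔼-allᶠ m {zero}          _     _ _      _        = 𝔼-const m 1ℚ
    𝔼-allᶠ m {suc n} {X} X-ind M {q} active inactive = by-head (M zero) refl
      where
      open Independent X-ind
      rest : Outcome → Bool
      rest G = allᶠ (λ x → X (suc x) G)
      IH : 𝔼 m (𝟙 ∘ rest) ≡ q ^ℚ count (M ∘ suc)
      IH = 𝔼-allᶠ m (independent-tail X-ind) (M ∘ suc) (active ∘ suc) (inactive ∘ suc)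
      by-head : ∀ b → M zero ≡ b →
                𝔼 m (λ G → 𝟙 (X zero G ∧ rest G)) ≡ q ^ℚ (𝟙ℕ b +ℕ count (M ∘ suc))
      by-head true eq = begin
        𝔼 m (λ G → 𝟙 (X zero G ∧ rest G))      ≡⟨ 𝔼-cong m (λ G → 𝟙-∧ (X zero G) (rest G)) ⟩
        𝔼 m (λ G → 𝟙 (X zero G) * 𝟙 (rest G))  ≡⟨ 𝔼-* m (support? zero) (dependsOn-∘ (depends zero) 𝟙)
                                                     (tail-dependsOn X-ind (𝟙 ∘ allᶠ) (cong 𝟙 ∘ allᶠ-cong)) ⟩
        𝔼 m (𝟙 ∘ X zero) * 𝔼 m (𝟙 ∘ rest)      ≡⟨ cong₂ _*_ (active zero (subst T (sym eq) tt)) IH ⟩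
        q * q ^ℚ count (M ∘ suc)               ∎
        where open ≡-Reasoning
      by-head false eq = trans (𝔼-cong m λ G → cong (λ b → 𝟙 (b ∧ rest G)) (X₀≡true G)) IH
        where
        X₀≡true : ∀ G → X zero G ≡ true
        X₀≡true G = Equivalence.to T-≡ (inactive zero (subst T eq) G)

    𝔼-not : ∀ m {X : Outcome → Bool} {q} → 𝔼 m (𝟙 ∘ X) ≡ q → 𝔼 m (𝟙 ∘ not ∘ X) ≡ 1ℚ - q
    𝔼-not m {X} 𝔼X = trans (𝔼-cong m (𝟙-not ∘ X)) (trans (𝔼-complement m (𝟙 ∘ X)) (cong (1ℚ -_) 𝔼X))

    𝔼-binomial-suc : ∀ m {A} {X₀ : Outcome → Bool} {C : Outcome → ℕ} {q r} →
      Decidable A → DependsOn A X₀ → (∀ j → DependsOn (∁ A) (λ G → 𝟙 (C G ≡ᵇ j))) →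
      𝔼 m (𝟙 ∘ X₀) ≡ q → (∀ j → 𝔼 m (λ G → 𝟙 (C G ≡ᵇ j)) ≡ binomPMF r q j) →
      ∀ i → 𝔼 m (λ G → 𝟙 (𝟙ℕ (X₀ G) +ℕ C G ≡ᵇ i)) ≡ binomPMF (suc r) q i
    𝔼-binomial-suc m {X₀ = X₀} {C} {q} {r} A? X₀-dep C-dep 𝔼X₀ 𝔼C zero = begin
      𝔼 m (λ G → 𝟙 (𝟙ℕ (X₀ G) +ℕ C G ≡ᵇ 0))
        ≡⟨ 𝔼-cong m (λ G → 𝟙-+≡ᵇ0 (X₀ G) (C G)) ⟩
      𝔼 m (λ G → 𝟙 (not (X₀ G)) * 𝟙 (C G ≡ᵇ 0))
        ≡⟨ 𝔼-* m A? (dependsOn-∘ X₀-dep (𝟙 ∘ not)) (C-dep 0) ⟩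
      𝔼 m (𝟙 ∘ not ∘ X₀) * 𝔼 m (λ G → 𝟙 (C G ≡ᵇ 0))
        ≡⟨ cong₂ _*_ (𝔼-not m {X₀} 𝔼X₀) (𝔼C 0) ⟩
      (1ℚ - q) * binomPMF r q 0
        ≡⟨ binomPMF-suc-zero r q ⟨
      binomPMF (suc r) q 0 ∎
      where open ≡-Reasoning
    𝔼-binomial-suc m {X₀ = X₀} {C} {q} {r} A? X₀-dep C-dep 𝔼X₀ 𝔼C (suc i) = begin
      𝔼 m (λ G → 𝟙 (𝟙ℕ (X₀ G) +ℕ C G ≡ᵇ suc i))
        ≡⟨ 𝔼-cong m (λ G → 𝟙-+≡ᵇsuc (X₀ G) (C G) i) ⟩
      𝔼 m (λ G → 𝟙 (X₀ G) * 𝟙 (C G ≡ᵇ i) + 𝟙 (not (X₀ G)) * 𝟙 (C G ≡ᵇ suc i))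
        ≡⟨ 𝔼-+ m _ _ ⟩
      𝔼 m (λ G → 𝟙 (X₀ G) * 𝟙 (C G ≡ᵇ i)) + 𝔼 m (λ G → 𝟙 (not (X₀ G)) * 𝟙 (C G ≡ᵇ suc i))
        ≡⟨ cong₂ _+_ (𝔼-* m A? (dependsOn-∘ X₀-dep 𝟙) (C-dep i))
                     (𝔼-* m A? (dependsOn-∘ X₀-dep (𝟙 ∘ not)) (C-dep (suc i))) ⟩
      𝔼 m (𝟙 ∘ X₀) * 𝔼 m (λ G → 𝟙 (C G ≡ᵇ i)) +
      𝔼 m (𝟙 ∘ not ∘ X₀) * 𝔼 m (λ G → 𝟙 (C G ≡ᵇ suc i))
        ≡⟨ cong₂ _+_ (cong₂ _*_ 𝔼X₀ (𝔼C i)) (cong₂ _*_ (𝔼-not m {X₀} 𝔼X₀) (𝔼C (suc i))) ⟩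
      q * binomPMF r q i + (1ℚ - q) * binomPMF r q (suc i)
        ≡⟨ binomPMF-suc-suc r q i ⟨
      binomPMF (suc r) q (suc i) ∎
      where open ≡-Reasoning

    𝔼-count : ∀ m {n} {X : Fin n → Outcome → Bool} → Independent X → (M : Fin n → Bool) → ∀ {q} →
              (∀ x → T (M x) → 𝔼 m (𝟙 ∘ X x) ≡ q) → (∀ x → ¬ T (M x) → ∀ G → ¬ T (X x G)) →
              ∀ i → 𝔼 m (λ G → 𝟙 (count (λ x → X x G) ≡ᵇ i)) ≡ binomPMF (count M) q i
    𝔼-count m {zero}  _ _ _ _ zero        = 𝔼-const m 1ℚ
    𝔼-count m {zero}  _ _ {q} _ _ (suc i) =
      trans (𝔼-const m 0ℚ) (sym (trans (cong (_* 1ℚ) (ℚ.*-zeroˡ (q * q ^ℚ i))) (ℚ.*-zeroˡ 1ℚ)))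
    𝔼-count m {suc n} {X} X-ind M {q} active inactive = by-head (M zero) refl
      where
      open Independent X-ind
      C : Outcome → ℕ
      C G = count (λ x → X (suc x) G)
      IH : ∀ j → 𝔼 m (λ G → 𝟙 (C G ≡ᵇ j)) ≡ binomPMF (count (M ∘ suc)) q j
      IH = 𝔼-count m (independent-tail X-ind) (M ∘ suc) (active ∘ suc) (inactive ∘ suc)
      by-head : ∀ b → M zero ≡ b →
                ∀ i → 𝔼 m (λ G → 𝟙 (𝟙ℕ (X zero G) +ℕ C G ≡ᵇ i)) ≡
                      binomPMF (𝟙ℕ b +ℕ count (M ∘ suc)) q i
      by-head true eq = 𝔼-binomial-suc m (support? zero) (depends zero)
        (λ j → tail-dependsOn X-ind (λ h → 𝟙 (count h ≡ᵇ j)) (cong (λ c → 𝟙 (c ≡ᵇ j)) ∘ count-cong))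
        (active zero (subst T (sym eq) tt)) IH
      by-head false eq i =
        trans (𝔼-cong m λ G → cong (λ b → 𝟙 (𝟙ℕ b +ℕ C G ≡ᵇ i)) (X₀≡false G)) (IH i)
        where
        X₀≡false : ∀ G → X zero G ≡ false
        X₀≡false G = ¬T⇒≡false (inactive zero (subst T eq) G)

module Graph where

  open Booleans
  open CoinFlips using (coin)
  open import Data.Bool using (Bool; true; false; T; T?; _∧_; _∨_; not; if_then_else_)
  open import Data.Bool.ListAction using (and)
  open import Data.Bool.Properties using (T-∧; T-∨; ∨-comm)
  open import Data.Empty using (⊥-elim)
  open import Data.Fin using (Fin; toℕ)
  import Data.Fin.Properties as Fin
  open import Data.Fin.Subset using (Subset)
  open import Data.List using (List; []; _∷_; length; cartesianProduct; allFin)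
  open import Data.List.Membership.Propositional using (_∈_; lose; find)
  open import Data.List.Membership.Propositional.Properties
    using (∈-filter⁺; ∈-filter⁻; ∈-cartesianProduct⁺; ∈-allFin)
  open import Data.List.Properties using (map-cong)
  open import Data.List.Relation.Unary.Any using (Any; here; there)
  import Data.List.Relation.Unary.All as All
  open import Data.List.Relation.Unary.All.Properties using (all⁺; all⁻)
  open import Data.Nat using (ℕ; suc; _<_; _≡ᵇ_; _<ᵇ_; z<s; s<s)
  import Data.Nat.Properties as ℕ
  open import Data.Product using (∃; _×_; _,_; proj₁; proj₂)
  open import Data.Sum using (_⊎_; inj₁; inj₂)
  open import Data.Unit using (tt)
  open import Data.Vec using (lookup)
  open import Function using (_∘_)
  open import Function.Bundles using (Equivalence)
  open import Relation.Binary.Definitions using (tri<; tri≈; tri>)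
  open import Relation.Binary.PropositionalEquality
  open import Relation.Nullary using (¬_)

  ≟ᶠ⇒≡ : ∀ {n} {u v : Fin n} → T (u ≟ᶠ v) → u ≡ v
  ≟ᶠ⇒≡ = Fin.toℕ-injective ∘ ℕ.≡ᵇ⇒≡ _ _

  ≟ᶠ-refl : ∀ {n} (u : Fin n) → T (u ≟ᶠ u)
  ≟ᶠ-refl u = ℕ.≡⇒≡ᵇ (toℕ u) (toℕ u) refl

  joins : ∀ {n} → Fin n → Fin n → Fin n × Fin n → Bool
  joins u v (a , b) = ((a ≟ᶠ u) ∧ (b ≟ᶠ v)) ∨ ((a ≟ᶠ v) ∧ (b ≟ᶠ u))

  joins-sym : ∀ {n} (u v : Fin n) e → joins u v e ≡ joins v u e
  joins-sym u v (a , b) = ∨-comm ((a ≟ᶠ u) ∧ (b ≟ᶠ v)) ((a ≟ᶠ v) ∧ (b ≟ᶠ u))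

  joins-endpoints : ∀ {n} {u v : Fin n} e → T (joins u v e) →
                    (proj₁ e ≡ u × proj₂ e ≡ v) ⊎ (proj₁ e ≡ v × proj₂ e ≡ u)
  joins-endpoints (a , b) t with Equivalence.to T-∨ t
  ... | inj₁ t′ = let (a≟u , b≟v) = Equivalence.to T-∧ t′ in inj₁ (≟ᶠ⇒≡ a≟u , ≟ᶠ⇒≡ b≟v)
  ... | inj₂ t′ = let (a≟v , b≟u) = Equivalence.to T-∧ t′ in inj₂ (≟ᶠ⇒≡ a≟v , ≟ᶠ⇒≡ b≟u)

  joins-self : ∀ {n} (u v : Fin n) → T (joins u v (u , v))
  joins-self u v = Equivalence.from T-∨ (inj₁ (Equivalence.from T-∧ (≟ᶠ-refl u , ≟ᶠ-refl v)))

  firstIndex : ∀ {A : Set} → (A → Bool) → List A → ℕ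
  firstIndex P []       = 0
  firstIndex P (x ∷ xs) = if P x then 0 else suc (firstIndex P xs)

  module _ {A : Set} (P : A → Bool) where

    firstIndex-< : ∀ {xs} → Any (T ∘ P) xs → firstIndex P xs < length xs
    firstIndex-< {x ∷ xs} any with P x in Px | any
    ... | true  | _         = z<s
    ... | false | there any = s<s (firstIndex-< any)
    ... | false | here px   = ⊥-elim (subst T Px px)

    firstIndex-common : ∀ (Q : A → Bool) {xs} → Any (T ∘ P) xs → firstIndex P xs ≡ firstIndex Q xs →
                        ∃ λ e → T (P e) × T (Q e)
    firstIndex-common Q {x ∷ xs} any eq with P x in Px | Q x in Qx | any
    ... | true  | true  | _         = x , subst T (sym Px) tt , subst T (sym Qx) tt
    ... | false | false | there any = firstIndex-common Q any (ℕ.suc-injective eq)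
    ... | false | _     | here px   = ⊥-elim (subst T Px px)

  module _ {n : ℕ} where

    adjAux-sym : ∀ (es : List (Fin n × Fin n)) G u v → adjAux es G u v ≡ adjAux es G v u
    adjAux-sym []              G       u v = refl
    adjAux-sym (_ ∷ _)         []      u v = refl
    adjAux-sym ((a , b) ∷ es) (x ∷ G) u v
      rewrite joins-sym u v (a , b) | adjAux-sym es G u v = refl

    adjAux≡coin : ∀ (es : List (Fin n × Fin n)) G {u v} → Any (T ∘ joins u v) es →
                  adjAux es G u v ≡ coin G (firstIndex (joins u v) es)
    adjAux≡coin ((a , b) ∷ es) []      _   = refl
    adjAux≡coin ((a , b) ∷ es) (x ∷ G) {u} {v} any with joins u v (a , b) in J | any
    ... | true  | _         = refl
    ... | false | there any = adjAux≡coin es G any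
    ... | false | here j    = ⊥-elim (subst T J j)

    adjAux⇒joins : ∀ (es : List (Fin n × Fin n)) G {u v} → T (adjAux es G u v) → Any (T ∘ joins u v) es
    adjAux⇒joins ((a , b) ∷ es) (x ∷ G) {u} {v} t with joins u v (a , b) in J
    ... | true  = here (subst T (sym J) tt)
    ... | false = there (adjAux⇒joins es G t)

  module EdgeCoordinates (n k : ℕ) where

    edges : List (Fin n × Fin n)
    edges = potentialEdges n k

    m : ℕ
    m = length edges

    index : Fin n → Fin n → ℕ
    index u v = firstIndex (joins u v) edges

    private
      isEdge : Fin n × Fin n → Bool
      isEdge e = (toℕ (proj₁ e) <ᵇ toℕ (proj₂ e)) ∧ not (part k (proj₁ e) ≡ᵇ part k (proj₂ e))

      isEdge⁺ : ∀ {a b} → toℕ a < toℕ b → part k a ≢ part k b → (a , b) ∈ edges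
      isEdge⁺ {a} {b} a<b a≁b = ∈-filter⁺ (T? ∘ isEdge) (∈-cartesianProduct⁺ (∈-allFin a) (∈-allFin b))
        (Equivalence.from T-∧ (ℕ.<⇒<ᵇ a<b , T-not⁺ (a≁b ∘ ℕ.≡ᵇ⇒≡ _ _)))

    edge-exists : ∀ {u v} → part k u ≢ part k v → Any (T ∘ joins u v) edges
    edge-exists {u} {v} u≁v with ℕ.<-cmp (toℕ u) (toℕ v)
    ... | tri< u<v _ _ = lose (isEdge⁺ u<v u≁v) (joins-self u v)
    ... | tri≈ _ u≡v _ = ⊥-elim (u≁v (cong (part k) (Fin.toℕ-injective u≡v)))
    ... | tri> _ _ v<u = lose (isEdge⁺ v<u (u≁v ∘ sym)) (subst T (joins-sym v u (v , u)) (joins-self v u))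

    edge-crossing : ∀ {a b} → (a , b) ∈ edges → part k a ≢ part k b
    edge-crossing {a} {b} e∈ a∼b =
      T-not⁻ (proj₂ (Equivalence.to T-∧ (proj₂ (∈-filter⁻ (T? ∘ isEdge) {xs = pairs} e∈)))) (ℕ.≡⇒≡ᵇ _ _ a∼b)
      where pairs = cartesianProduct (allFin n) (allFin n)

    module _ {u v : Fin n} (u≁v : part k u ≢ part k v) where

      adj≡coin : ∀ G → adj n k G u v ≡ coin G (index u v)
      adj≡coin G = adjAux≡coin edges G (edge-exists u≁v)

      index<m : index u v < m
      index<m = firstIndex-< (joins u v) (edge-exists u≁v)

      index-endpoints : ∀ {u′ v′} → index u v ≡ index u′ v′ →
                        (u ≡ u′ × v ≡ v′) ⊎ (u ≡ v′ × v ≡ u′)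
      index-endpoints {u′} {v′} eq
        with e , j , j′ ← firstIndex-common (joins u v) (joins u′ v′) (edge-exists u≁v) eq
        with joins-endpoints e j | joins-endpoints e j′
      ... | inj₁ (refl , refl) | inj₁ (refl , refl) = inj₁ (refl , refl)
      ... | inj₁ (refl , refl) | inj₂ (refl , refl) = inj₂ (refl , refl)
      ... | inj₂ (refl , refl) | inj₁ (refl , refl) = inj₂ (refl , refl)
      ... | inj₂ (refl , refl) | inj₂ (refl , refl) = inj₁ (refl , refl)

    adj-sym : ∀ G u v → adj n k G u v ≡ adj n k G v u
    adj-sym = adjAux-sym edges

    adj-samePart : ∀ G {u v} → part k u ≡ part k v → ¬ T (adj n k G u v)
    adj-samePart G u∼v t with find (adjAux⇒joins edges G t)
    ... | (a , b) , e∈ , j with joins-endpoints (a , b) j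
    ...   | inj₁ (refl , refl) = edge-crossing e∈ u∼v
    ...   | inj₂ (refl , refl) = edge-crossing e∈ (sym u∼v)

  module Cliques (n k : ℕ) where

    private
      distinctPair : Subset n → Fin n → Fin n → Bool
      distinctPair S u v = lookup S u ∧ lookup S v ∧ not (u ≟ᶠ v)

      distinctPair⁺ : ∀ {S u v} → T (lookup S u) → T (lookup S v) → u ≢ v → T (distinctPair S u v)
      distinctPair⁺ Su Sv u≢v = Equivalence.from T-∧ (Su , Equivalence.from T-∧
        (Sv , T-not⁺ (u≢v ∘ ≟ᶠ⇒≡)))

      distinctPair⁻ : ∀ {S u v} → T (distinctPair S u v) → T (lookup S u) × T (lookup S v) × u ≢ v
      distinctPair⁻ {S} {u} {v} t =
        let (Su , t′) = Equivalence.to T-∧ t ; (Sv , t″) = Equivalence.to T-∧ t′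
        in Su , Sv , λ { refl → T-not⁻ t″ (≟ᶠ-refl u) }

      pairs : List (Fin n × Fin n)
      pairs = cartesianProduct (allFin n) (allFin n)

      clause : Outcome → Subset n → Fin n × Fin n → Bool
      clause G S e = not (distinctPair S (proj₁ e) (proj₂ e)) ∨ adj n k G (proj₁ e) (proj₂ e)

    isClique⁺ : ∀ G S → (∀ {u v} → T (lookup S u) → T (lookup S v) → u ≢ v → T (adj n k G u v)) →
                T (isClique n k G S)
    isClique⁺ G S clique = all⁻ (clause G S) (All.universal (λ (u , v) → implies⁺ λ t →
      let (Su , Sv , u≢v) = distinctPair⁻ {S} t in clique Su Sv u≢v) pairs)

    isClique⁻ : ∀ G S → T (isClique n k G S) →
                ∀ {u v} → T (lookup S u) → T (lookup S v) → u ≢ v → T (adj n k G u v)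
    isClique⁻ G S t {u} {v} Su Sv u≢v =
      implies⁻ (All.lookup (all⁺ (clause G S) pairs t) (∈-cartesianProduct⁺ (∈-allFin u) (∈-allFin v)))
               (distinctPair⁺ {S} Su Sv u≢v)

    isClique-cong : ∀ G G′ S →
                    (∀ {u v} → T (lookup S u) → T (lookup S v) → u ≢ v → adj n k G u v ≡ adj n k G′ u v) →
                    isClique n k G S ≡ isClique n k G′ S
    isClique-cong G G′ S same = cong and (map-cong (λ (u , v) → implies-cong λ t →
      let (Su , Sv , u≢v) = distinctPair⁻ {S} t in same Su Sv u≢v) pairs)

open import Data.Bool using (_∧_)
open import Data.Nat using (ℕ; suc; _∸_; _≡ᵇ_; _≥_)
open import Data.Nat.Divisibility using (_∣_)
open import Data.Fin.Subset using (Subset; _∈_; ∣_∣)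
open import Data.Rational using (ℚ; 0ℚ; 1ℚ; _≤_; _*_)
open import Relation.Binary.PropositionalEquality using (_≡_; sym; cong₂; module ≡-Reasoning)

module Exchange (n k : ℕ) (σ : Subset n) (|σ|≡1+k : ∣ σ ∣ ≡ suc k)
  (σ-distinctParts : ∀ u v → u ∈ σ → v ∈ σ → part k u ≡ part k v → u ≡ v) where

  open Booleans
  open Counting
  open SubsetEnumeration
  open CoinFlips
  open Binomial
  open Graph
  open import Data.Bool using (Bool; true; false; T; T?; _∧_; _∨_; not)
  open import Data.Bool.Properties using (T-≡; T-∧; T-∨; ∧-comm; ∨-identityʳ)
  open import Data.Empty using (⊥-elim)
  open import Data.Fin using (Fin; toℕ; _≟_)
  import Data.Fin.Properties as Fin
  open import Data.Fin.Properties using (any?)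
  open import Data.Fin.Subset using (_∩_; _∪_) renaming (∁ to ∁ˢ)
  open import Data.Fin.Subset.Properties using (∣∁p∣≡n∸∣p∣)
  open import Data.Nat using (_+_; _∸_; _≡ᵇ_)
  open import Data.Nat.DivMod using (_mod_)
  import Data.Nat.Properties as ℕ
  open import Data.Product using (∃; ∃!; _×_; _,_; proj₁; proj₂)
  open import Data.Rational using (ℚ; _*_)
  import Data.Rational.Properties as ℚ
  open import Data.Sum using (_⊎_; inj₁; inj₂)
  open import Data.Unit using (tt)
  open import Data.Vec using (lookup; tabulate)
  import Data.Vec.Properties as Vec
  open import Function using (_∘_; case_of_)
  open import Function.Bundles using (Equivalence)
  open import Level using (0ℓ)
  open import Relation.Binary.PropositionalEquality
  open import Relation.Nullary using (¬_; does; yes; no)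
  open import Relation.Nullary.Decidable using (dec-true; dec-false; _×-dec_; ¬?; decidable-stable)
  open import Relation.Unary using (Pred; Decidable; ∁; _⊆_)

  σ-transversal : ∀ {u v} → T (lookup σ u) → T (lookup σ v) → part k u ≡ part k v → u ≡ v
  σ-transversal {u} {v} σu σv = σ-distinctParts u v (∈σ σu) (∈σ σv)
    where
    ∈σ : ∀ {x} → T (lookup σ x) → x ∈ σ
    ∈σ {x} t = Vec.lookup⇒[]= x σ (Equivalence.to T-≡ t)

  open Cliques n k
  open EdgeCoordinates n k using (adj-sym; adj-samePart)

  count-σ : count (lookup σ) ≡ suc k
  count-σ = trans (sym (∣p∣≡count σ)) |σ|≡1+k

  private
    class : Fin n → Fin (suc k)
    class v = toℕ v mod suc k

    class⇒part : ∀ {u v} → class u ≡ class v → part k u ≡ part k v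
    class⇒part {u} {v} eq = trans (sym (Fin.toℕ-fromℕ< _)) (trans (cong toℕ eq) (Fin.toℕ-fromℕ< _))

    σ-meets-part : ∀ w → ∃ λ u → T (lookup σ u) × part k u ≡ part k w
    σ-meets-part w =
      let (u , t , _) = count≡1⇒∃! (fibres-of-transversal (lookup σ) class count-σ
                          (λ {u} {v} σu σv → σ-transversal σu σv ∘ class⇒part {u} {v}) (class w))
          (σu , u∼w) = Equivalence.to T-∧ t
      in u , σu , class⇒part {u} {w} (does⇒ (class u ≟ class w) u∼w)

  rep : Fin n → Fin n
  rep w = proj₁ (σ-meets-part w)

  rep-∈ : ∀ w → T (lookup σ (rep w))
  rep-∈ w = proj₁ (proj₂ (σ-meets-part w))

  rep-part : ∀ w → part k (rep w) ≡ part k w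
  rep-part w = proj₂ (proj₂ (σ-meets-part w))

  rep-unique : ∀ w {v} → T (lookup σ v) → part k v ≡ part k w → v ≡ rep w
  rep-unique w σv v∼w = σ-transversal σv (rep-∈ w) (trans v∼w (sym (rep-part w)))

  σ-without : Fin n → Fin n → Bool
  σ-without u x = lookup σ x ∧ not (does (x ≟ u))

  count-σ-without : ∀ {u} → T (lookup σ u) → count (σ-without u) ≡ k
  count-σ-without σu = ℕ.suc-injective (trans (sym (count-remove (lookup σ) σu)) count-σ)

  exchange : Fin n → Subset n
  exchange w = tabulate (λ x → σ-without (rep w) x ∨ does (x ≟ w))

  module _ {w : Fin n} (w∉σ : ¬ T (lookup σ w)) where

    lookup-exchange : ∀ x → lookup (exchange w) x ≡ σ-without (rep w) x ∨ does (x ≟ w)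
    lookup-exchange = Vec.lookup∘tabulate _

    rep≢w : rep w ≢ w
    rep≢w eq = w∉σ (subst (T ∘ lookup σ) eq (rep-∈ w))

    w∈exchange : T (lookup (exchange w) w)
    w∈exchange = subst T (sym (lookup-exchange w)) (Equivalence.from T-∨ (inj₂ (⇒does (w ≟ w) refl)))

    ∈exchange⁻ : ∀ {x} → T (lookup (exchange w) x) → (T (lookup σ x) × x ≢ rep w) ⊎ x ≡ w
    ∈exchange⁻ {x} t with Equivalence.to T-∨ (subst T (lookup-exchange x) t)
    ... | inj₁ t′ = let (σx , x≉r) = Equivalence.to T-∧ t′
                    in inj₁ (σx , T-not⁻ x≉r ∘ ⇒does (x ≟ rep w))
    ... | inj₂ x≈w = inj₂ (does⇒ (x ≟ w) x≈w)

    ∣exchange∣ : ∣ exchange w ∣ ≡ suc k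
    ∣exchange∣ = begin
      ∣ exchange w ∣                                      ≡⟨ ∣p∣≡count (exchange w) ⟩
      count (lookup (exchange w))                         ≡⟨ count-cong lookup-exchange ⟩
      count (λ x → σ-without (rep w) x ∨ does (x ≟ w))
        ≡⟨ count-insert (σ-without (rep w)) (w∉σ ∘ proj₁ ∘ Equivalence.to T-∧) ⟩
      suc (count (σ-without (rep w)))                     ≡⟨ cong suc (count-σ-without (rep-∈ w)) ⟩
      suc k                                               ∎
      where open ≡-Reasoning

    ∣σ∩exchange∣ : ∣ σ ∩ exchange w ∣ ≡ k
    ∣σ∩exchange∣ = begin
      ∣ σ ∩ exchange w ∣                                ≡⟨ ∣p∣≡count (σ ∩ exchange w) ⟩
      count (lookup (σ ∩ exchange w))                   ≡⟨ count-cong σ∩exchange≡σ-without ⟩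
      count (σ-without (rep w))                         ≡⟨ count-σ-without (rep-∈ w) ⟩
      k                                                 ∎
      where
      open ≡-Reasoning
      σ∩exchange≡σ-without : ∀ x → lookup (σ ∩ exchange w) x ≡ σ-without (rep w) x
      σ∩exchange≡σ-without x rewrite Vec.lookup-zipWith _∧_ x σ (exchange w) | lookup-exchange x
        with lookup σ x in σx | x ≟ w
      ... | false | _        = refl
      ... | true  | no _     = ∨-identityʳ _
      ... | true  | yes refl = ⊥-elim (w∉σ (subst T (sym σx) tt))

  ≡exchange : ∀ {τ w} → ¬ T (lookup σ w) → T (lookup τ w) → ¬ T (lookup τ (rep w)) →
              (∀ {x} → T (lookup τ x) → ¬ T (lookup σ x) → x ≡ w) →
              (∀ {x} → T (lookup σ x) → ¬ T (lookup τ x) → x ≡ rep w) →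
              τ ≡ exchange w
  ≡exchange {τ} {w} w∉σ w∈τ rep∉τ added removed =
    trans (sym (Vec.tabulate∘lookup τ)) (Vec.tabulate-cong pointwise)
    where
    pointwise : ∀ x → lookup τ x ≡ σ-without (rep w) x ∨ does (x ≟ w)
    pointwise x with lookup σ x in σx | lookup τ x in τx
    ... | true  | true  rewrite dec-false (x ≟ rep w) (λ { refl → rep∉τ (subst T (sym τx) tt) }) = refl
    ... | true  | false rewrite dec-true (x ≟ rep w) (removed (subst T (sym σx) tt) (subst T τx))
                              | dec-false (x ≟ w) (λ { refl → w∉σ (subst T (sym σx) tt) }) = refl
    ... | false | true  rewrite dec-true (x ≟ w) (added (subst T (sym τx) tt) (subst T σx)) = refl
    ... | false | false rewrite dec-false (x ≟ w) (λ { refl → subst T τx w∈τ }) = refl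

  outsidePart : Fin n → Fin n → Bool
  outsidePart w v = lookup σ v ∧ not (part k v ≡ᵇ part k w)

  count-outsidePart : ∀ w → count (outsidePart w) ≡ k
  count-outsidePart w = ℕ.suc-injective (begin
    1 + count (outsidePart w)                                        ≡⟨ cong (_+ count (outsidePart w)) inPart≡1 ⟨
    count (λ v → lookup σ v ∧ (part k v ≡ᵇ part k w)) + count (outsidePart w)
                                                                     ≡⟨ count-split (lookup σ) (λ v → part k v ≡ᵇ part k w) ⟨
    count (lookup σ)                                                 ≡⟨ count-σ ⟩
    suc k                                                            ∎)
    where
    open ≡-Reasoning
    inPart≡1 : count (λ v → lookup σ v ∧ (part k v ≡ᵇ part k w)) ≡ 1
    inPart≡1 = count≡1 (rep w , Equivalence.from T-∧ (rep-∈ w , ℕ.≡⇒≡ᵇ _ _ (rep-part w)) , λ t →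
      let (σv , v∼w) = Equivalence.to T-∧ t in sym (rep-unique w σv (ℕ.≡ᵇ⇒≡ _ _ v∼w)))

  outsidePart⁺ : ∀ w {v} → T (lookup σ v) → part k v ≢ part k w → T (outsidePart w v)
  outsidePart⁺ w σv v≁w = Equivalence.from T-∧ (σv , T-not⁺ (v≁w ∘ ℕ.≡ᵇ⇒≡ _ _))

  outsidePart⁻ : ∀ w {v} → T (outsidePart w v) → T (lookup σ v) × part k v ≢ part k w
  outsidePart⁻ w t =
    let (σv , v≁w) = Equivalence.to T-∧ t
    in σv , T-not⁻ v≁w ∘ ℕ.≡⇒≡ᵇ _ _

  seesOutsidePart : Outcome → Fin n → Bool
  seesOutsidePart G w = allᶠ (λ v → not (outsidePart w v) ∨ adj n k G w v)

  seesOutsidePart⁺ : ∀ {G w} → (∀ {v} → T (lookup σ v) → part k v ≢ part k w → T (adj n k G w v)) →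
                     T (seesOutsidePart G w)
  seesOutsidePart⁺ {G} {w} sees = allᶠ⁺ {h = λ v → not (outsidePart w v) ∨ adj n k G w v} λ v →
    implies⁺ λ t → let (σv , v≁w) = outsidePart⁻ w t in sees σv v≁w

  seesOutsidePart⁻ : ∀ {G w} → T (seesOutsidePart G w) →
                     ∀ {v} → T (lookup σ v) → part k v ≢ part k w → T (adj n k G w v)
  seesOutsidePart⁻ {G} {w} t {v} σv v≁w =
    implies⁻ (allᶠ⁻ {h = λ v → not (outsidePart w v) ∨ adj n k G w v} t v) (outsidePart⁺ w σv v≁w)

  exchangeable : Outcome → Fin n → Bool
  exchangeable G w = not (lookup σ w) ∧ seesOutsidePart G w

  isNeighbour : Outcome → Subset n → Bool
  isNeighbour G τ =
    (∣ τ ∣ ≡ᵇ suc k) ∧ isClique n k G τ ∧ (∣ σ ∩ τ ∣ ≡ᵇ k) ∧ not (isClique n k G (σ ∪ τ))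

  isNeighbour⁻ : ∀ {G τ} → T (isNeighbour G τ) →
                 ∣ τ ∣ ≡ suc k × T (isClique n k G τ) × ∣ σ ∩ τ ∣ ≡ k
  isNeighbour⁻ {G} {τ} t =
    let (|τ| , t₁) = Equivalence.to (T-∧ {∣ τ ∣ ≡ᵇ suc k}) t
        (clique , t₂) = Equivalence.to (T-∧ {isClique n k G τ}) t₁
        (|σ∩τ| , _) = Equivalence.to (T-∧ {∣ σ ∩ τ ∣ ≡ᵇ k}) t₂
    in ℕ.≡ᵇ⇒≡ _ _ |τ| , clique , ℕ.≡ᵇ⇒≡ _ _ |σ∩τ|

  module _ {G : Outcome} (σ-clique : T (isClique n k G σ)) where

    exchange-clique : ∀ {w} → ¬ T (lookup σ w) → T (seesOutsidePart G w) → T (isClique n k G (exchange w))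
    exchange-clique {w} w∉σ sees = isClique⁺ G (exchange w) λ tx ty x≢y →
      case ∈exchange⁻ w∉σ tx , ∈exchange⁻ w∉σ ty of λ where
        (inj₁ (σx , _)   , inj₁ (σy , _))   → isClique⁻ G σ σ-clique σx σy x≢y
        (inj₁ (σx , x≢r) , inj₂ refl)       →
          subst T (adj-sym G w _) (seesOutsidePart⁻ sees σx (x≢r ∘ rep-unique w σx))
        (inj₂ refl       , inj₁ (σy , y≢r)) → seesOutsidePart⁻ sees σy (y≢r ∘ rep-unique w σy)
        (inj₂ refl       , inj₂ refl)       → ⊥-elim (x≢y refl)

    σ∪exchange-not-clique : ∀ {w} → ¬ T (lookup σ w) → ¬ T (isClique n k G (σ ∪ exchange w))
    σ∪exchange-not-clique {w} w∉σ clique =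
      adj-samePart G (rep-part w)
        (isClique⁻ G (σ ∪ exchange w) clique (∈∪ (inj₁ (rep-∈ w))) (∈∪ (inj₂ (w∈exchange w∉σ))) (rep≢w w∉σ))
      where
      ∈∪ : ∀ {x} → T (lookup σ x) ⊎ T (lookup (exchange w) x) → T (lookup (σ ∪ exchange w) x)
      ∈∪ {x} t = subst T (sym (Vec.lookup-zipWith _∨_ x σ (exchange w))) (Equivalence.from T-∨ t)

    exchange-isNeighbour : ∀ {w} → T (exchangeable G w) → T (isNeighbour G (exchange w))
    exchange-isNeighbour {w} t =
      let (w∉σ′ , sees) = Equivalence.to T-∧ t
          w∉σ = T-not⁻ w∉σ′
      in Equivalence.from T-∧ (ℕ.≡⇒≡ᵇ _ _ (∣exchange∣ w∉σ) ,
         Equivalence.from T-∧ (exchange-clique w∉σ sees ,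
         Equivalence.from T-∧ (ℕ.≡⇒≡ᵇ _ _ (∣σ∩exchange∣ w∉σ) , T-not⁺ (σ∪exchange-not-clique w∉σ))))

    module _ {τ : Subset n} (τ-neighbour : T (isNeighbour G τ)) where

      private
        |τ|≡1+k : count (lookup τ) ≡ suc k
        |τ|≡1+k = trans (sym (∣p∣≡count τ)) (proj₁ (isNeighbour⁻ {G} {τ} τ-neighbour))

        τ-clique : T (isClique n k G τ)
        τ-clique = proj₁ (proj₂ (isNeighbour⁻ {G} {τ} τ-neighbour))

        |σ∧τ|≡k : count (λ x → lookup σ x ∧ lookup τ x) ≡ k
        |σ∧τ|≡k = trans (count-cong λ x → sym (Vec.lookup-zipWith _∧_ x σ τ))
                        (trans (sym (∣p∣≡count (σ ∩ τ))) (proj₂ (proj₂ (isNeighbour⁻ {G} {τ} τ-neighbour))))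

        added : ∃! _≡_ (λ x → T (lookup τ x ∧ not (lookup σ x)))
        added = count≡1⇒∃! (count-∧not≡1 (lookup τ) (lookup σ) |τ|≡1+k
                             (trans (count-cong λ x → ∧-comm (lookup τ x) (lookup σ x)) |σ∧τ|≡k))

        removed : ∃! _≡_ (λ x → T (lookup σ x ∧ not (lookup τ x)))
        removed = count≡1⇒∃! (count-∧not≡1 (lookup σ) (lookup τ) count-σ |σ∧τ|≡k)

        w : Fin n
        w = proj₁ added

        w∈τ : T (lookup τ w)
        w∈τ = proj₁ (Equivalence.to T-∧ (proj₁ (proj₂ added)))

        w∉σ : ¬ T (lookup σ w)
        w∉σ = T-not⁻ (proj₂ (Equivalence.to T-∧ (proj₁ (proj₂ added))))

        added-unique : ∀ {x} → T (lookup τ x) → ¬ T (lookup σ x) → x ≡ w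
        added-unique τx x∉σ = sym (proj₂ (proj₂ added) (Equivalence.from T-∧ (τx , T-not⁺ x∉σ)))

        removed-unique : ∀ {x y} → T (lookup σ x) → ¬ T (lookup τ x) → T (lookup σ y) → ¬ T (lookup τ y) →
                         x ≡ y
        removed-unique σx x∉τ σy y∉τ =
          trans (sym (proj₂ (proj₂ removed) (Equivalence.from T-∧ (σx , T-not⁺ x∉τ))))
                (proj₂ (proj₂ removed) (Equivalence.from T-∧ (σy , T-not⁺ y∉τ)))

        rep∉τ : ¬ T (lookup τ (rep w))
        rep∉τ τr = adj-samePart G (rep-part w) (isClique⁻ G τ τ-clique τr w∈τ (rep≢w w∉σ))

        removed≡rep : ∀ {x} → T (lookup σ x) → ¬ T (lookup τ x) → x ≡ rep w
        removed≡rep σx x∉τ = removed-unique σx x∉τ (rep-∈ w) rep∉τ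

        sees : T (seesOutsidePart G w)
        sees = seesOutsidePart⁺ λ {v} σv v≁w →
          let v∈τ = decidable-stable (T? (lookup τ v)) λ v∉τ →
                      v≁w (trans (cong (part k) (removed≡rep σv v∉τ)) (rep-part w))
          in isClique⁻ G τ τ-clique w∈τ v∈τ (λ { refl → w∉σ σv })

      isNeighbour⇒exchange : ∃ λ w → T (exchangeable G w) × τ ≡ exchange w
      isNeighbour⇒exchange = w , Equivalence.from T-∧ (T-not⁺ w∉σ , sees) ,
                              ≡exchange w∉σ w∈τ rep∉τ added-unique removed≡rep

    deg≡count-exchangeable : deg n k G σ ≡ count (exchangeable G)
    deg≡count-exchangeable =
      length-filter≡count-preimage (isNeighbour G) (exchangeable G) exchange exchange-injective
        exchange-isNeighbour isNeighbour⇒exchange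
      where
      exchange-injective : ∀ {x y} → T (exchangeable G x) → T (exchangeable G y) →
                           exchange x ≡ exchange y → x ≡ y
      exchange-injective {x} {y} tx ty eq
        with ∈exchange⁻ (T-not⁻ (proj₁ (Equivalence.to T-∧ ty))) (subst (λ τ → T (lookup τ x)) eq
               (w∈exchange (T-not⁻ (proj₁ (Equivalence.to T-∧ tx)))))
      ... | inj₁ (σx , _) = ⊥-elim (T-not⁻ (proj₁ (Equivalence.to T-∧ tx)) σx)
      ... | inj₂ x≡y      = x≡y

  𝟙-clique∧deg : ∀ G i → 𝟙 (isClique n k G σ ∧ (deg n k G σ ≡ᵇ i)) ≡
                          𝟙 (isClique n k G σ) * 𝟙 (count (exchangeable G) ≡ᵇ i)
  𝟙-clique∧deg G i with isClique n k G σ in eq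
  ... | true  = trans (cong (λ d → 𝟙 (d ≡ᵇ i)) (deg≡count-exchangeable (subst T (sym eq) tt)))
                      (sym (ℚ.*-identityˡ _))
  ... | false = sym (ℚ.*-zeroˡ (𝟙 (count (exchangeable G) ≡ᵇ i)))

  open EdgeCoordinates n k using (m; index; adj≡coin; index<m; index-endpoints)

  innerEdge : Pred ℕ 0ℓ
  innerEdge j = ∃ λ u → T (lookup σ u) × ∃ λ v → T (outsidePart u v) × index u v ≡ j

  innerEdge? : Decidable innerEdge
  innerEdge? j = any? λ u → T? (lookup σ u) ×-dec any? λ v → T? (outsidePart u v) ×-dec (index u v ℕ.≟ j)

  spoke : Fin n → Pred ℕ 0ℓ
  spoke w j = ¬ T (lookup σ w) × ∃ λ v → T (outsidePart w v) × index w v ≡ j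

  spoke? : ∀ w → Decidable (spoke w)
  spoke? w j = ¬? (T? (lookup σ w)) ×-dec any? λ v → T? (outsidePart w v) ×-dec (index w v ℕ.≟ j)

  σ-clique-dependsOn : DependsOn innerEdge (λ G → isClique n k G σ)
  σ-clique-dependsOn = dependsOn λ {G} {G′} G≈G′ → isClique-cong G G′ σ λ {u} {v} σu σv u≢v →
    let u≁v = u≢v ∘ σ-transversal σu σv
    in trans (adj≡coin u≁v G)
             (trans (G≈G′ (u , σu , v , outsidePart⁺ u σv (u≁v ∘ sym) , refl)) (sym (adj≡coin u≁v G′)))

  spoke⊆∁innerEdge : ∀ w → spoke w ⊆ ∁ innerEdge
  spoke⊆∁innerEdge w (w∉σ , v , wv , refl) (u , σu , v′ , uv′ , eq)
    with index-endpoints (proj₂ (outsidePart⁻ w wv) ∘ sym) (sym eq)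
  ... | inj₁ (refl , _) = w∉σ σu
  ... | inj₂ (refl , _) = w∉σ (proj₁ (outsidePart⁻ u uv′))

  exchangeable-independent : Independent (λ w G → exchangeable G w)
  exchangeable-independent = record
    { support  = spoke
    ; support? = spoke?
    ; disjoint = spokes-disjoint
    ; depends  = λ w → dependsOn λ {G} {G′} G≈G′ →
        ∧-cong-T λ w∉σ → allᶠ-cong λ v → implies-cong λ wv →
        let w≁v = proj₂ (outsidePart⁻ w wv) ∘ sym
        in trans (adj≡coin w≁v G) (trans (G≈G′ (T-not⁻ w∉σ , v , wv , refl)) (sym (adj≡coin w≁v G′)))
    }
    where
    spokes-disjoint : ∀ {w w′ j} → spoke w j → spoke w′ j → w ≡ w′
    spokes-disjoint {w} {w′} (w∉σ , v , wv , refl) (_ , v′ , w′v′ , eq)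
      with index-endpoints (proj₂ (outsidePart⁻ w wv) ∘ sym) (sym eq)
    ... | inj₁ (w≡w′ , _) = w≡w′
    ... | inj₂ (refl , _) = ⊥-elim (w∉σ (proj₁ (outsidePart⁻ w′ w′v′)))

  count-outside-σ : count (not ∘ lookup σ) ≡ n ∸ k ∸ 1
  count-outside-σ = begin
    count (not ∘ lookup σ)        ≡⟨ count-cong (λ x → sym (Vec.lookup-map x not σ)) ⟩
    count (lookup (∁ˢ σ))         ≡⟨ ∣p∣≡count (∁ˢ σ) ⟨
    ∣ ∁ˢ σ ∣                      ≡⟨ ∣∁p∣≡n∸∣p∣ σ ⟩
    n ∸ ∣ σ ∣                     ≡⟨ cong (n ∸_) (trans |σ|≡1+k (ℕ.+-comm 1 k)) ⟩
    n ∸ (k + 1)                   ≡⟨ ℕ.∸-+-assoc n k 1 ⟨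
    n ∸ k ∸ 1                     ∎
    where open ≡-Reasoning

  module _ (p : ℚ) where
    open Bernoulli p

    𝔼-exchangeable : ∀ {w} → ¬ T (lookup σ w) → 𝔼 m (λ G → 𝟙 (exchangeable G w)) ≡ p ^ℚ k
    𝔼-exchangeable {w} w∉σ = begin
      𝔼 m (λ G → 𝟙 (exchangeable G w))
        ≡⟨ 𝔼-cong m (λ G → cong 𝟙 (trans (cong (_∧ seesOutsidePart G w) (Equivalence.to T-≡ (T-not⁺ w∉σ)))
                                         (sees≡coins G))) ⟩
      𝔼 m (λ G → 𝟙 (allᶠ (λ v → not (outsidePart w v) ∨ coin G (index w v))))
        ≡⟨ 𝔼-allᶠ p m spoke-coins (outsidePart w) active inactive ⟩
      p ^ℚ count (outsidePart w)
        ≡⟨ cong (p ^ℚ_) (count-outsidePart w) ⟩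
      p ^ℚ k ∎
      where
      open ≡-Reasoning
      w≁ : ∀ {v} → T (outsidePart w v) → part k w ≢ part k v
      w≁ wv = proj₂ (outsidePart⁻ w wv) ∘ sym
      sees≡coins : ∀ G → seesOutsidePart G w ≡ allᶠ (λ v → not (outsidePart w v) ∨ coin G (index w v))
      sees≡coins G = allᶠ-cong λ v → implies-cong λ wv → adj≡coin {w} {v} (w≁ wv) G
      spoke-coins : Independent (λ v G → not (outsidePart w v) ∨ coin G (index w v))
      spoke-coins = record
        { support  = λ v j → T (outsidePart w v) × index w v ≡ j
        ; support? = λ v j → T? (outsidePart w v) ×-dec (index w v ℕ.≟ j)
        ; disjoint = λ { {v} {v′} (wv , refl) (wv′ , eq) → case index-endpoints (w≁ wv) (sym eq) of λ where
                           (inj₁ (_ , v≡v′)) → v≡v′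
                           (inj₂ (refl , _)) → ⊥-elim (w∉σ (proj₁ (outsidePart⁻ w wv′))) }
        ; depends  = λ v → dependsOn λ G≈G′ → implies-cong λ wv → G≈G′ (wv , refl)
        }
      active : ∀ v → T (outsidePart w v) → 𝔼 m (λ G → 𝟙 (not (outsidePart w v) ∨ coin G (index w v))) ≡ p
      active v wv rewrite Equivalence.to T-≡ wv = 𝔼-coin (index<m (w≁ wv))
      inactive : ∀ v → ¬ T (outsidePart w v) → ∀ G → T (not (outsidePart w v) ∨ coin G (index w v))
      inactive v ¬wv G = Equivalence.from T-∨ (inj₁ (T-not⁺ ¬wv))

    𝔼-count-exchangeable : ∀ i →
      𝔼 m (λ G → 𝟙 (count (exchangeable G) ≡ᵇ i)) ≡ binomPMF (n ∸ k ∸ 1) (p ^ℚ k) i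
    𝔼-count-exchangeable i =
      trans (𝔼-count p m exchangeable-independent (not ∘ lookup σ) (λ w → 𝔼-exchangeable ∘ T-not⁻)
                     (λ w σw G → σw ∘ proj₁ ∘ Equivalence.to T-∧) i)
            (cong (λ r → binomPMF r (p ^ℚ k) i) count-outside-σ)

    σ-clique⊥exchangeable : ∀ i →
      𝔼 m (λ G → 𝟙 (isClique n k G σ) * 𝟙 (count (exchangeable G) ≡ᵇ i)) ≡
      𝔼 m (λ G → 𝟙 (isClique n k G σ)) * 𝔼 m (λ G → 𝟙 (count (exchangeable G) ≡ᵇ i))
    σ-clique⊥exchangeable i =
      𝔼-* m innerEdge? (dependsOn-∘ σ-clique-dependsOn 𝟙)
        (family-dependsOn exchangeable-independent spoke⊆∁innerEdge (λ h → 𝟙 (count h ≡ᵇ i))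
                          (cong (λ c → 𝟙 (c ≡ᵇ i)) ∘ count-cong))

lemma2 : (k n : ℕ) → k ≥ 1 → suc k ∣ n → (p : ℚ) → 0ℚ ≤ p → p ≤ 1ℚ
    → (σ : Subset n) → ∣ σ ∣ ≡ suc k
    → (∀ u v → u ∈ σ → v ∈ σ → part k u ≡ part k v → u ≡ v)
    → (i : ℕ)
    → Pr n k p (λ G → isClique n k G σ ∧ (deg n k G σ ≡ᵇ i))
    ≡ Pr n k p (λ G → isClique n k G σ) * binomPMF (n ∸ k ∸ 1) (p ^ℚ k) i
lemma2 k n _ _ p _ _ σ |σ|≡1+k σ-distinctParts i = begin
  Pr n k p (λ G → isClique n k G σ ∧ (deg n k G σ ≡ᵇ i))
    ≡⟨ Pr≡𝔼 n k (λ G → isClique n k G σ ∧ (deg n k G σ ≡ᵇ i)) ⟩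
  𝔼 m (λ G → 𝟙 (isClique n k G σ ∧ (deg n k G σ ≡ᵇ i)))
    ≡⟨ 𝔼-cong m (λ G → 𝟙-clique∧deg G i) ⟩
  𝔼 m (λ G → 𝟙 (isClique n k G σ) * 𝟙 (count (exchangeable G) ≡ᵇ i))
    ≡⟨ σ-clique⊥exchangeable p i ⟩
  𝔼 m (λ G → 𝟙 (isClique n k G σ)) * 𝔼 m (λ G → 𝟙 (count (exchangeable G) ≡ᵇ i))
    ≡⟨ cong₂ _*_ (sym (Pr≡𝔼 n k (λ G → isClique n k G σ))) (𝔼-count-exchangeable p i) ⟩
  Pr n k p (λ G → isClique n k G σ) * binomPMF (n ∸ k ∸ 1) (p ^ℚ k) i ∎
  where
  open ≡-Reasoning
  open CoinFlips using (𝟙; module Bernoulli)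
  open Bernoulli p
  open Counting using (count)
  open Graph.EdgeCoordinates n k using (m)
  open Exchange n k σ |σ|≡1+k σ-distinctParts
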